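{- Let $h_5(z)=\sum_{n=0}^\infty c_nz^n$ be the power series whose coefficients are determined by $c_{ -1}=0$, $c_0=1$ and the three-term recurrence $$(2n-1)^2\,c_{n-1} + 2(44n^2+22n+5)\,c_n + 500(n+1)^2\,c_{n+1}=0,\qquad n\ge 0.$$ This series defines an analytic function $h_5$ in a neighborhood of $0\in\mathbb{C}$. Put $A(x)=x^4+5x^3+15x^2+25x+25$. Then for all $x$ in a neighborhood of $0$, $$h_5\bigl(x\,A(x)\bigr)=5\,A(x)^{ -1/2}\,h_5\!\left(\frac{x^5}{A(x)}\right),$$ where $A(x)^{ -1/2}$ denotes the branch equal to $1/5$ at $x=0$. -}

module Defs where

open import Data.Nat using (ℕ; zero; suc; _∸_)
open import Data.Integer using (+_)
open import Data.Product using (_×_; _,_; proj₁; proj₂)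
open import Data.Rational using (ℚ; _+_; _*_; -_; _-_; _/_; 0ℚ; 1ℚ)

ℕ→ℚ : ℕ → ℚ
ℕ→ℚ n = + n / 1

Series : Set
Series = ℕ → ℚ

sumBelow : ℕ → (ℕ → ℚ) → ℚ
sumBelow zero    f = 0ℚ
sumBelow (suc n) f = sumBelow n f + f n

_⊛_ : Series → Series → Series
(f ⊛ g) n = sumBelow (suc n) (λ i → f i * g (n ∸ i))

_•_ : ℚ → Series → Series
(a • f) n = a * f n

_^ˢ_ : Series → ℕ → Series
f ^ˢ zero = λ { zero → 1ℚ ; (suc _) → 0ℚ }
f ^ˢ suc k = f ⊛ (f ^ˢ k)

-- Formal composition f(g(x)); meaningful when g has zero constant term
-- (then the k-th power of g has no terms below degree k, so truncating
-- the sum at k ≤ n is exact).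
_∘ˢ_ : Series → Series → Series
(f ∘ˢ g) n = sumBelow (suc n) (λ k → f k * (g ^ˢ k) n)

X : Series
X (suc zero) = 1ℚ
X _          = 0ℚ

A : Series
A 0 = ℕ→ℚ 25
A 1 = ℕ→ℚ 25
A 2 = ℕ→ℚ 15
A 3 = ℕ→ℚ 5
A 4 = 1ℚ
A _ = 0ℚ

gbinom : ℚ → ℕ → ℚ
gbinom α zero    = 1ℚ
gbinom α (suc k) = gbinom α k * (α - ℕ→ℚ k) * (+ 1 / suc k)

binomSeries : ℚ → Series
binomSeries α = gbinom α

-- u(x) = A(x)/25 - 1  (zero constant term), so A = 25 (1+u).
U : Series
U zero    = 0ℚ
U (suc n) = (+ 1 / 25) * A (suc n)

-- A(x)^{-1/2}, branch equal to 1/5 at x = 0:  (1/5)(1+u)^{-1/2}.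
AinvSqrt : Series
AinvSqrt = (+ 1 / 5) • (binomSeries (- (+ 1 / 2)) ∘ˢ U)

Ainv : Series
Ainv = (+ 1 / 25) • (binomSeries (- 1ℚ) ∘ˢ U)

-- Coefficients of h_5: cpair n = (c_{n-1}, c_n), with c_{-1} = 0, c_0 = 1 and
-- (2n-1)^2 c_{n-1} + 2(44n^2+22n+5) c_n + 500(n+1)^2 c_{n+1} = 0.
cnext : ℕ → ℚ → ℚ → ℚ
cnext n p q =
  - ((+ 1 / 500) * (+ 1 / suc n) * (+ 1 / suc n)
     * ( (ℕ→ℚ 2 * m - 1ℚ) * (ℕ→ℚ 2 * m - 1ℚ) * p
       + ℕ→ℚ 2 * (ℕ→ℚ 44 * m * m + ℕ→ℚ 22 * m + ℕ→ℚ 5) * q))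
  where m = ℕ→ℚ n

cpair : ℕ → ℚ × ℚ
cpair zero    = 0ℚ , 1ℚ
cpair (suc n) = proj₂ (cpair n) , cnext n (proj₁ (cpair n)) (proj₂ (cpair n))

h5 : Series
h5 n = proj₂ (cpair n)

lhs : Series
lhs = h5 ∘ˢ (X ⊛ A)

rhs : Series
rhs = ℕ→ℚ 5 • (AinvSqrt ⊛ (h5 ∘ˢ ((X ^ˢ 5) ⊛ Ainv)))

-- Both sides are killed by one Euler-type operator L = p₂θ² + p₁θ + p₀, θ = x d/dx.
-- The recurrence says that h5 solves
--   z (500 + 88z + 4z²) h″ + (500 + 132z + 8z²) h′ + (10 + z) h = 0,
-- and L is this equation pulled back along T = x A(x) with the denominator (θT)³ cleared,
-- so the chain rule gives L (h5 ∘ T) = 0.  For the right-hand side put S = x⁵/A and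
-- B = A^(-1/2); the binomial series give A S = x⁵ and 2 A θB = - B θA, and with these
-- 4A⁴ L (B · (h5 ∘ S)) = B Σ Cᵢ (Dⁱh5 ∘ S) for explicit polynomials Cᵢ.  The identity
-- behind the theorem is that 25 Cᵢ = μ Eᵢ for one polynomial μ, where Σ Eᵢ (Dⁱh5 ∘ S)
-- is A³ times the equation of h5 along S; hence L kills the right-hand side as well.
-- The coefficients of L vanish to order 2 and their x²-parts form 312500 θ², which has
-- no positive integer root, so a power series f with L f = 0 is determined by f 0.

module Submission where

open import Data.Nat as ℕ using (ℕ; zero; suc; _∸_; _<_; _≤_; s≤s)
import Data.Nat.Properties as ℕ
open import Data.Integer as ℤ using (ℤ)
import Data.Integer.Properties as ℤ
open import Data.List as List using (List; []; _∷_)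
open import Data.Maybe using (Maybe; just; nothing)
open import Data.Product using (_,_; proj₁)
open import Data.Sum using (inj₁; inj₂)
open import Data.Rational using (ℚ; mkℚ; _+_; _*_; -_; _-_; _/_; 1/_; 0ℚ; 1ℚ; ≢-nonZero)
import Data.Nat.Coprimality as Coprime
import Data.Rational.Properties as ℚ
open import Level using (0ℓ)
open import Relation.Nullary using (yes; no)
open import Function using (_∘_)
open import Relation.Binary.PropositionalEquality
open import Algebra.Bundles using (CommutativeRing)
open import Algebra.Structures using (IsCommutativeRing)
open import Algebra.Solver.Ring.AlmostCommutativeRing
  using (_-Raw-AlmostCommutative⟶_; fromCommutativeRing)
import Algebra.Solver.Ring
open import Tactic.RingSolver using (solve-∀)
import Tactic.RingSolver.Core.AlmostCommutativeRing as Reflective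

open import Defs renaming (_⊛_ to infixl 7 _⊛_; _•_ to infixr 7 _•_; _^ˢ_ to infixr 8 _^ˢ_)

ℚ-ring : Reflective.AlmostCommutativeRing 0ℓ 0ℓ
ℚ-ring = Reflective.fromCommutativeRing ℚ.+-*-commutativeRing isZero?
  where
  isZero? : ∀ x → Maybe (0ℚ ≡ x)
  isZero? x with 0ℚ ℚ.≟ x
  ... | yes 0≡x = just 0≡x
  ... | no  _   = nothing

ℤ→ℚ : ℤ → ℚ
ℤ→ℚ z = z / 1

ℤ→ℚ-canonical : ∀ z → ℤ→ℚ z ≡ mkℚ z 0 (Coprime.sym (Coprime.1-coprimeTo _))
ℤ→ℚ-canonical z = ℚ.↥p/↧p≡p (mkℚ z 0 (Coprime.sym (Coprime.1-coprimeTo _)))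

ℤ→ℚ-homo-+ : ∀ a b → ℤ→ℚ (a ℤ.+ b) ≡ ℤ→ℚ a + ℤ→ℚ b
ℤ→ℚ-homo-+ a b rewrite ℤ→ℚ-canonical a | ℤ→ℚ-canonical b =
  cong (_/ 1) (sym (cong₂ ℤ._+_ (ℤ.*-identityʳ a) (ℤ.*-identityʳ b)))

ℤ→ℚ-homo-* : ∀ a b → ℤ→ℚ (a ℤ.* b) ≡ ℤ→ℚ a * ℤ→ℚ b
ℤ→ℚ-homo-* a b rewrite ℤ→ℚ-canonical a | ℤ→ℚ-canonical b = refl

ℤ→ℚ-homo‿- : ∀ a → ℤ→ℚ (ℤ.- a) ≡ - ℤ→ℚ a
ℤ→ℚ-homo‿- (ℤ.+ zero)    = refl
ℤ→ℚ-homo‿- (ℤ.+[1+ n ])  = refl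
ℤ→ℚ-homo‿- (ℤ.-[1+ n ])  = sym (neg-involutive _)
  where
  neg-involutive : ∀ x → - - x ≡ x
  neg-involutive = solve-∀ ℚ-ring

ℕ→ℚ-homo-+ : ∀ m n → ℕ→ℚ (m ℕ.+ n) ≡ ℕ→ℚ m + ℕ→ℚ n
ℕ→ℚ-homo-+ m n = ℤ→ℚ-homo-+ (ℤ.+ m) (ℤ.+ n)

ℕ→ℚ-suc≢0 : ∀ n → ℕ→ℚ (suc n) ≢ 0ℚ
ℕ→ℚ-suc≢0 n eq with trans (sym (ℤ→ℚ-canonical (ℤ.+ suc n))) eq
... | ()

*≡0⇒≡0 : ∀ {a b} → a ≢ 0ℚ → a * b ≡ 0ℚ → b ≡ 0ℚ
*≡0⇒≡0 {a} {b} a≢0 ab≡0 = begin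
  b                ≡⟨ sym (ℚ.*-identityˡ b) ⟩
  1ℚ * b           ≡⟨ cong (_* b) (sym (ℚ.*-inverseˡ a)) ⟩
  (1/ a * a) * b   ≡⟨ ℚ.*-assoc (1/ a) a b ⟩
  1/ a * (a * b)   ≡⟨ cong (1/ a *_) ab≡0 ⟩
  1/ a * 0ℚ        ≡⟨ ℚ.*-zeroʳ (1/ a) ⟩
  0ℚ               ∎
  where
  open ≡-Reasoning
  instance _ = ≢-nonZero a≢0

ℕ→ℚ-*-reciprocal : ∀ m → ℕ→ℚ (suc m) * (ℤ.+ 1 / suc m) ≡ 1ℚ
ℕ→ℚ-*-reciprocal m = begin
  ℕ→ℚ (suc m) * (ℤ.+ 1 / suc m)
    ≡⟨ cong₂ _*_ (ℤ→ℚ-canonical (ℤ.+ suc m)) (ℚ.normalize-coprime (Coprime.1-coprimeTo (suc m))) ⟩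
  p * 1/ p
    ≡⟨ ℚ.*-inverseʳ p ⟩
  1ℚ ∎
  where
  open ≡-Reasoning
  p : ℚ
  p = mkℚ (ℤ.+ suc m) 0 (Coprime.sym (Coprime.1-coprimeTo (suc m)))

sumBelow-cong : ∀ n {f g : ℕ → ℚ} → (∀ i → i < n → f i ≡ g i) → sumBelow n f ≡ sumBelow n g
sumBelow-cong zero    f≡g = refl
sumBelow-cong (suc n) f≡g =
  cong₂ _+_ (sumBelow-cong n (λ i i<n → f≡g i (ℕ.m<n⇒m<1+n i<n))) (f≡g n ℕ.≤-refl)

sumBelow-zero : ∀ n {f : ℕ → ℚ} → (∀ i → i < n → f i ≡ 0ℚ) → sumBelow n f ≡ 0ℚ
sumBelow-zero n f≡0 = trans (sumBelow-cong n f≡0) (zeros n)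
  where
  zeros : ∀ n → sumBelow n (λ _ → 0ℚ) ≡ 0ℚ
  zeros zero    = refl
  zeros (suc n) = trans (cong (_+ 0ℚ) (zeros n)) (ℚ.+-identityʳ 0ℚ)

sumBelow-distrib-+ : ∀ n (f g : ℕ → ℚ) →
                     sumBelow n (λ i → f i + g i) ≡ sumBelow n f + sumBelow n g
sumBelow-distrib-+ zero    f g = refl
sumBelow-distrib-+ (suc n) f g = begin
  sumBelow n (λ i → f i + g i) + (f n + g n)   ≡⟨ cong (_+ (f n + g n)) (sumBelow-distrib-+ n f g) ⟩
  (sumBelow n f + sumBelow n g) + (f n + g n)  ≡⟨ +-interchange (sumBelow n f) (sumBelow n g) (f n) (g n) ⟩
  sumBelow (suc n) f + sumBelow (suc n) g      ∎
  where
  open ≡-Reasoning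
  +-interchange : ∀ a b c d → (a + b) + (c + d) ≡ (a + c) + (b + d)
  +-interchange = solve-∀ ℚ-ring

*-distribˡ-sumBelow : ∀ n a (f : ℕ → ℚ) → a * sumBelow n f ≡ sumBelow n (λ i → a * f i)
*-distribˡ-sumBelow zero    a f = ℚ.*-zeroʳ a
*-distribˡ-sumBelow (suc n) a f =
  trans (ℚ.*-distribˡ-+ a (sumBelow n f) (f n)) (cong (_+ a * f n) (*-distribˡ-sumBelow n a f))

*-distribʳ-sumBelow : ∀ n a (f : ℕ → ℚ) → sumBelow n f * a ≡ sumBelow n (λ i → f i * a)
*-distribʳ-sumBelow n a f = begin
  sumBelow n f * a                ≡⟨ ℚ.*-comm (sumBelow n f) a ⟩
  a * sumBelow n f                ≡⟨ *-distribˡ-sumBelow n a f ⟩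
  sumBelow n (λ i → a * f i)      ≡⟨ sumBelow-cong n (λ i _ → ℚ.*-comm a (f i)) ⟩
  sumBelow n (λ i → f i * a)      ∎
  where open ≡-Reasoning

sumBelow-head : ∀ n (f : ℕ → ℚ) → sumBelow (suc n) f ≡ f 0 + sumBelow n (λ i → f (suc i))
sumBelow-head zero    f = trans (ℚ.+-identityˡ (f 0)) (sym (ℚ.+-identityʳ (f 0)))
sumBelow-head (suc n) f = begin
  sumBelow (suc n) f + f (suc n)                     ≡⟨ cong (_+ f (suc n)) (sumBelow-head n f) ⟩
  (f 0 + sumBelow n (λ i → f (suc i))) + f (suc n)   ≡⟨ ℚ.+-assoc (f 0) _ _ ⟩
  f 0 + sumBelow (suc n) (λ i → f (suc i))           ∎
  where open ≡-Reasoning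

sumBelow-extend : ∀ {n m} (f : ℕ → ℚ) → n ≤ m → (∀ i → n ≤ i → f i ≡ 0ℚ) →
                  sumBelow m f ≡ sumBelow n f
sumBelow-extend {n} {m} f n≤m f≡0 =
  trans (cong (λ k → sumBelow k f) (sym (ℕ.m∸n+n≡m n≤m))) (pad (m ∸ n))
  where
  pad : ∀ k → sumBelow (k ℕ.+ n) f ≡ sumBelow n f
  pad zero    = refl
  pad (suc k) = trans (cong₂ _+_ (pad k) (f≡0 (k ℕ.+ n) (ℕ.m≤n+m n k))) (ℚ.+-identityʳ _)

sumBelow-swap : ∀ n m (F : ℕ → ℕ → ℚ) →
                sumBelow n (λ i → sumBelow m (F i)) ≡ sumBelow m (λ j → sumBelow n (λ i → F i j))
sumBelow-swap zero    m F = sym (sumBelow-zero m (λ _ _ → refl))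
sumBelow-swap (suc n) m F = begin
  sumBelow n (λ i → sumBelow m (F i)) + sumBelow m (F n)
    ≡⟨ cong (_+ sumBelow m (F n)) (sumBelow-swap n m F) ⟩
  sumBelow m (λ j → sumBelow n (λ i → F i j)) + sumBelow m (F n)
    ≡⟨ sym (sumBelow-distrib-+ m _ _) ⟩
  sumBelow m (λ j → sumBelow (suc n) (λ i → F i j)) ∎
  where open ≡-Reasoning

sumBelow-reverse : ∀ n (f : ℕ → ℚ) → sumBelow (suc n) (λ i → f (n ∸ i)) ≡ sumBelow (suc n) f
sumBelow-reverse zero    f = refl
sumBelow-reverse (suc n) f = begin
  sumBelow (suc (suc n)) (λ i → f (suc n ∸ i))   ≡⟨ sumBelow-head (suc n) _ ⟩
  f (suc n) + sumBelow (suc n) (λ i → f (n ∸ i)) ≡⟨ cong (f (suc n) +_) (sumBelow-reverse n f) ⟩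
  f (suc n) + sumBelow (suc n) f                 ≡⟨ ℚ.+-comm (f (suc n)) _ ⟩
  sumBelow (suc (suc n)) f                       ∎
  where open ≡-Reasoning

sumBelow-triangle : ∀ n (F : ℕ → ℕ → ℚ) →
  sumBelow (suc n) (λ m → sumBelow (suc m) (λ i → F i m)) ≡
  sumBelow (suc n) (λ i → sumBelow (suc (n ∸ i)) (λ j → F i (i ℕ.+ j)))
sumBelow-triangle zero    F = refl
sumBelow-triangle (suc n) F = begin
  sumBelow (suc n) (λ m → sumBelow (suc m) (λ i → F i m)) + (column + F (suc n) (suc n))
    ≡⟨ cong (_+ (column + F (suc n) (suc n))) (sumBelow-triangle n F) ⟩
  rows n + (column + F (suc n) (suc n))
    ≡⟨ sym (ℚ.+-assoc (rows n) column _) ⟩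
  (rows n + column) + F (suc n) (suc n)
    ≡⟨ cong₂ _+_ (trans (sym (sumBelow-distrib-+ (suc n) _ _)) (sumBelow-cong (suc n) extend-row))
                 (trans (cong (F (suc n)) (sym (ℕ.+-identityʳ (suc n)))) (sym (ℚ.+-identityˡ _))) ⟩
  rows (suc n) + sumBelow 1 (λ j → F (suc n) (suc n ℕ.+ j))
    ≡⟨ cong (λ k → rows (suc n) + sumBelow (suc k) (λ j → F (suc n) (suc n ℕ.+ j))) (sym (ℕ.n∸n≡0 n)) ⟩
  sumBelow (suc (suc n)) (λ i → sumBelow (suc (suc n ∸ i)) (λ j → F i (i ℕ.+ j))) ∎
  where
  open ≡-Reasoning
  column : ℚ
  column = sumBelow (suc n) (λ i → F i (suc n))
  rows : ℕ → ℚ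
  rows k = sumBelow (suc n) (λ i → sumBelow (suc (k ∸ i)) (λ j → F i (i ℕ.+ j)))
  extend-row : ∀ i → i < suc n →
    sumBelow (suc (n ∸ i)) (λ j → F i (i ℕ.+ j)) + F i (suc n) ≡ sumBelow (suc (suc n ∸ i)) (λ j → F i (i ℕ.+ j))
  extend-row i (s≤s i≤n) rewrite ℕ.+-∸-assoc 1 i≤n =
    cong (λ k → sumBelow (suc (n ∸ i)) (λ j → F i (i ℕ.+ j)) + F i k)
         (sym (trans (ℕ.+-suc i (n ∸ i)) (cong suc (ℕ.m+[n∸m]≡n i≤n))))

infix  4 _≈_
infixl 6 _⊕_
infix  8 ⊝_

_≈_ : Series → Series → Set
f ≈ g = ∀ n → f n ≡ g n

_⊕_ : Series → Series → Series
(f ⊕ g) n = f n + g n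

⊝_ : Series → Series
(⊝ f) n = - f n

0ˢ : Series
0ˢ _ = 0ℚ

const : ℚ → Series
const c zero    = c
const c (suc _) = 0ℚ

1ˢ : Series
1ˢ = const 1ℚ

≈-refl : ∀ {f} → f ≈ f
≈-refl n = refl

≈-sym : ∀ {f g} → f ≈ g → g ≈ f
≈-sym f≈g n = sym (f≈g n)

≈-trans : ∀ {f g h} → f ≈ g → g ≈ h → f ≈ h
≈-trans f≈g g≈h n = trans (f≈g n) (g≈h n)

⊕-cong : ∀ {f f′ g g′} → f ≈ f′ → g ≈ g′ → f ⊕ g ≈ f′ ⊕ g′
⊕-cong f≈f′ g≈g′ n = cong₂ _+_ (f≈f′ n) (g≈g′ n)

⊛-cong : ∀ {f f′ g g′} → f ≈ f′ → g ≈ g′ → f ⊛ g ≈ f′ ⊛ g′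
⊛-cong f≈f′ g≈g′ n = sumBelow-cong (suc n) (λ i _ → cong₂ _*_ (f≈f′ i) (g≈g′ (n ∸ i)))

⊕-congˡ : ∀ f {g g′} → g ≈ g′ → f ⊕ g ≈ f ⊕ g′
⊕-congˡ f = ⊕-cong (≈-refl {f})

⊕-congʳ : ∀ g {f f′} → f ≈ f′ → f ⊕ g ≈ f′ ⊕ g
⊕-congʳ g f≈f′ = ⊕-cong f≈f′ (≈-refl {g})

⊛-congˡ : ∀ f {g g′} → g ≈ g′ → f ⊛ g ≈ f ⊛ g′
⊛-congˡ f = ⊛-cong (≈-refl {f})

⊛-congʳ : ∀ g {f f′} → f ≈ f′ → f ⊛ g ≈ f′ ⊛ g
⊛-congʳ g f≈f′ = ⊛-cong f≈f′ (≈-refl {g})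

⊛-comm : ∀ f g → f ⊛ g ≈ g ⊛ f
⊛-comm f g n = begin
  sumBelow (suc n) (λ i → f i * g (n ∸ i))              ≡⟨ sym (sumBelow-reverse n _) ⟩
  sumBelow (suc n) (λ i → f (n ∸ i) * g (n ∸ (n ∸ i)))  ≡⟨ sumBelow-cong (suc n) swap-factors ⟩
  sumBelow (suc n) (λ i → g i * f (n ∸ i))              ∎
  where
  open ≡-Reasoning
  swap-factors : ∀ i → i < suc n → f (n ∸ i) * g (n ∸ (n ∸ i)) ≡ g i * f (n ∸ i)
  swap-factors i (s≤s i≤n) =
    trans (ℚ.*-comm (f (n ∸ i)) _) (cong (λ k → g k * f (n ∸ i)) (ℕ.m∸[m∸n]≡n i≤n))

⊛-assoc : ∀ f g h → (f ⊛ g) ⊛ h ≈ f ⊛ (g ⊛ h)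
⊛-assoc f g h n = begin
  sumBelow (suc n) (λ m → sumBelow (suc m) (λ i → f i * g (m ∸ i)) * h (n ∸ m))
    ≡⟨ sumBelow-cong (suc n) (λ m _ → *-distribʳ-sumBelow (suc m) (h (n ∸ m)) _) ⟩
  sumBelow (suc n) (λ m → sumBelow (suc m) (λ i → f i * g (m ∸ i) * h (n ∸ m)))
    ≡⟨ sumBelow-triangle n (λ i m → f i * g (m ∸ i) * h (n ∸ m)) ⟩
  sumBelow (suc n) (λ i → sumBelow (suc (n ∸ i)) (λ j → f i * g (i ℕ.+ j ∸ i) * h (n ∸ (i ℕ.+ j))))
    ≡⟨ sumBelow-cong (suc n) (λ i _ → trans (sumBelow-cong (suc (n ∸ i)) (λ j _ → reindex i j))
                                             (sym (*-distribˡ-sumBelow (suc (n ∸ i)) (f i) _))) ⟩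
  sumBelow (suc n) (λ i → f i * sumBelow (suc (n ∸ i)) (λ j → g j * h (n ∸ i ∸ j))) ∎
  where
  open ≡-Reasoning
  reindex : ∀ i j → f i * g (i ℕ.+ j ∸ i) * h (n ∸ (i ℕ.+ j)) ≡ f i * (g j * h (n ∸ i ∸ j))
  reindex i j = trans (ℚ.*-assoc (f i) _ _)
    (cong₂ (λ k l → f i * (g k * h l)) (ℕ.m+n∸m≡n i j) (sym (ℕ.∸-+-assoc n i j)))

⊛-distribˡ-⊕ : ∀ f g h → f ⊛ (g ⊕ h) ≈ f ⊛ g ⊕ f ⊛ h
⊛-distribˡ-⊕ f g h n =
  trans (sumBelow-cong (suc n) (λ i _ → ℚ.*-distribˡ-+ (f i) (g (n ∸ i)) (h (n ∸ i))))
        (sumBelow-distrib-+ (suc n) _ _)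

const-⊛ : ∀ c f → const c ⊛ f ≈ c • f
const-⊛ c f n = begin
  sumBelow (suc n) (λ i → const c i * f (n ∸ i))   ≡⟨ sumBelow-head n _ ⟩
  c * f n + sumBelow n (λ i → 0ℚ * f (n ∸ suc i))  ≡⟨ cong (c * f n +_) (sumBelow-zero n (λ i _ → ℚ.*-zeroˡ (f (n ∸ suc i)))) ⟩
  c * f n + 0ℚ                                     ≡⟨ ℚ.+-identityʳ _ ⟩
  c * f n                                          ∎
  where open ≡-Reasoning

⊛-zeroʳ : ∀ f → f ⊛ 0ˢ ≈ 0ˢ
⊛-zeroʳ f n = sumBelow-zero (suc n) (λ i _ → ℚ.*-zeroʳ (f i))

⊛-identityˡ : ∀ f → 1ˢ ⊛ f ≈ f
⊛-identityˡ f = ≈-trans (const-⊛ 1ℚ f) (λ n → ℚ.*-identityˡ (f n))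

series-isCommutativeRing : IsCommutativeRing _≈_ _⊕_ _⊛_ ⊝_ 0ˢ 1ˢ
series-isCommutativeRing = record
  { isRing = record
    { +-isAbelianGroup = record
      { isGroup = record
        { isMonoid = record
          { isSemigroup = record
            { isMagma = record
              { isEquivalence = record { refl = ≈-refl ; sym = ≈-sym ; trans = ≈-trans }
              ; ∙-cong = ⊕-cong }
            ; assoc = λ f g h n → ℚ.+-assoc (f n) (g n) (h n) }
          ; identity = (λ f n → ℚ.+-identityˡ (f n)) , (λ f n → ℚ.+-identityʳ (f n)) }
        ; inverse = (λ f n → ℚ.+-inverseˡ (f n)) , (λ f n → ℚ.+-inverseʳ (f n))
        ; ⁻¹-cong = λ f≈g n → cong -_ (f≈g n) }
      ; comm = λ f g n → ℚ.+-comm (f n) (g n) }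
    ; *-cong = ⊛-cong
    ; *-assoc = ⊛-assoc
    ; *-identity = ⊛-identityˡ , (λ f → ≈-trans (⊛-comm f 1ˢ) (⊛-identityˡ f))
    ; distrib = ⊛-distribˡ-⊕ , λ f g h → ≈-trans (⊛-comm (g ⊕ h) f)
                  (≈-trans (⊛-distribˡ-⊕ f g h) (⊕-cong (⊛-comm f g) (⊛-comm f h))) }
  ; *-comm = ⊛-comm }

series-commutativeRing : CommutativeRing 0ℓ 0ℓ
series-commutativeRing = record { isCommutativeRing = series-isCommutativeRing }

const-homo-+ : ∀ a b → const (a + b) ≈ const a ⊕ const b
const-homo-+ a b zero    = refl
const-homo-+ a b (suc n) = refl

const-homo-* : ∀ a b → const (a * b) ≈ const a ⊛ const b
const-homo-* a b n = trans (pointwise n) (sym (const-⊛ a (const b) n))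
  where
  pointwise : ∀ n → const (a * b) n ≡ a * const b n
  pointwise zero    = refl
  pointwise (suc n) = sym (ℚ.*-zeroʳ a)

const-homo‿- : ∀ a → const (- a) ≈ ⊝ const a
const-homo‿- a zero    = refl
const-homo‿- a (suc n) = refl

const-0ˢ : const 0ℚ ≈ 0ˢ
const-0ˢ zero    = refl
const-0ˢ (suc n) = refl

const-cong : ∀ {a b} → a ≡ b → const a ≈ const b
const-cong refl = ≈-refl

fromℤ : ℤ → Series
fromℤ z = const (ℤ→ℚ z)

fromℤ-morphism : CommutativeRing.rawRing ℤ.+-*-commutativeRing
                   -Raw-AlmostCommutative⟶ fromCommutativeRing series-commutativeRing
fromℤ-morphism = record
  { ⟦_⟧    = fromℤ
  ; +-homo = λ a b → ≈-trans (const-cong (ℤ→ℚ-homo-+ a b)) (const-homo-+ _ _)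
  ; *-homo = λ a b → ≈-trans (const-cong (ℤ→ℚ-homo-* a b)) (const-homo-* _ _)
  ; -‿homo = λ a → ≈-trans (const-cong (ℤ→ℚ-homo‿- a)) (const-homo‿- _)
  ; 0-homo = const-0ˢ
  ; 1-homo = ≈-refl
  }

fromℤ-≟ : ∀ a b → Maybe (fromℤ a ≈ fromℤ b)
fromℤ-≟ a b with a ℤ.≟ b
... | yes refl = just ≈-refl
... | no  _    = nothing

open Algebra.Solver.Ring _ _ fromℤ-morphism fromℤ-≟ public
  using (Polynomial; solve; _:=_; _:+_; _:*_; :-_; _:-_; con)

⟨_⟩ : ℕ → Series
⟨ n ⟩ = fromℤ (ℤ.+ n)

κ : ∀ {m} → ℕ → Polynomial m
κ n = con (ℤ.+ n)

module ≈-Reasoning where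
  open import Relation.Binary.Reasoning.Setoid (CommutativeRing.setoid series-commutativeRing) public

⊝-cong : ∀ {f g} → f ≈ g → ⊝ f ≈ ⊝ g
⊝-cong f≈g n = cong -_ (f≈g n)

⊛-vanishes : ∀ m {e} → e ≈ 0ˢ → m ⊛ e ≈ 0ˢ
⊛-vanishes m e≈0 = ≈-trans (⊛-congˡ m e≈0) (⊛-zeroʳ m)

⊕-vanishes : ∀ {e e′} → e ≈ 0ˢ → e′ ≈ 0ˢ → e ⊕ e′ ≈ 0ˢ
⊕-vanishes e≈0 e′≈0 n = trans (cong₂ _+_ (e≈0 n) (e′≈0 n)) (ℚ.+-identityˡ 0ℚ)

⊝-vanishes : ∀ {e} → e ≈ 0ˢ → ⊝ e ≈ 0ˢ
⊝-vanishes = ⊝-cong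

⊕-absorbs : ∀ f {e} → e ≈ 0ˢ → f ⊕ e ≈ f
⊕-absorbs f e≈0 n = trans (cong (f n +_) (e≈0 n)) (ℚ.+-identityʳ (f n))

•≈const⊛ : ∀ c f → c • f ≈ const c ⊛ f
•≈const⊛ c f = ≈-sym (const-⊛ c f)

X⊛-zero : ∀ f → (X ⊛ f) 0 ≡ 0ℚ
X⊛-zero f = trans (ℚ.+-identityˡ _) (ℚ.*-zeroˡ (f 0))

X⊛-suc : ∀ f n → (X ⊛ f) (suc n) ≡ f n
X⊛-suc f n = begin
  sumBelow (suc (suc n)) (λ i → X i * f (suc n ∸ i))
    ≡⟨ sumBelow-head (suc n) _ ⟩
  0ℚ * f (suc n) + sumBelow (suc n) (λ i → X (suc i) * f (n ∸ i))
    ≡⟨ cong₂ _+_ (ℚ.*-zeroˡ (f (suc n))) (sumBelow-head n _) ⟩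
  0ℚ + (1ℚ * f n + sumBelow n (λ i → 0ℚ * f (n ∸ suc i)))
    ≡⟨ cong (λ s → 0ℚ + (1ℚ * f n + s)) (sumBelow-zero n (λ i _ → ℚ.*-zeroˡ (f (n ∸ suc i)))) ⟩
  0ℚ + (1ℚ * f n + 0ℚ)
    ≡⟨ trans (ℚ.+-identityˡ _) (trans (ℚ.+-identityʳ _) (ℚ.*-identityˡ (f n))) ⟩
  f n ∎
  where open ≡-Reasoning

X⊛-cancel : ∀ f → X ⊛ f ≈ 0ˢ → f ≈ 0ˢ
X⊛-cancel f X⊛f≈0 n = trans (sym (X⊛-suc f n)) (X⊛f≈0 (suc n))

θ : Series → Series
θ f n = ℕ→ℚ n * f n

D : Series → Series
D f n = ℕ→ℚ (suc n) * f (suc n)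

θ-cong : ∀ {f g} → f ≈ g → θ f ≈ θ g
θ-cong f≈g n = cong (ℕ→ℚ n *_) (f≈g n)

θ-⊕ : ∀ f g → θ (f ⊕ g) ≈ θ f ⊕ θ g
θ-⊕ f g n = ℚ.*-distribˡ-+ (ℕ→ℚ n) (f n) (g n)

θ-⊝ : ∀ f → θ (⊝ f) ≈ ⊝ θ f
θ-⊝ f n = sym (ℚ.neg-distribʳ-* (ℕ→ℚ n) (f n))

θ-• : ∀ c f → θ (c • f) ≈ c • θ f
θ-• c f n = trans (sym (ℚ.*-assoc (ℕ→ℚ n) c (f n)))
                  (trans (cong (_* f n) (ℚ.*-comm (ℕ→ℚ n) c)) (ℚ.*-assoc c (ℕ→ℚ n) (f n)))

θ-const : ∀ c → θ (const c) ≈ 0ˢ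
θ-const c zero    = ℚ.*-zeroˡ c
θ-const c (suc n) = ℚ.*-zeroʳ (ℕ→ℚ (suc n))

θ-⊛ : ∀ f g → θ (f ⊛ g) ≈ θ f ⊛ g ⊕ f ⊛ θ g
θ-⊛ f g n = begin
  ℕ→ℚ n * sumBelow (suc n) (λ i → f i * g (n ∸ i))
    ≡⟨ *-distribˡ-sumBelow (suc n) (ℕ→ℚ n) _ ⟩
  sumBelow (suc n) (λ i → ℕ→ℚ n * (f i * g (n ∸ i)))
    ≡⟨ sumBelow-cong (suc n) split-weight ⟩
  sumBelow (suc n) (λ i → ℕ→ℚ i * f i * g (n ∸ i) + f i * (ℕ→ℚ (n ∸ i) * g (n ∸ i)))
    ≡⟨ sumBelow-distrib-+ (suc n) _ _ ⟩
  (θ f ⊛ g) n + (f ⊛ θ g) n ∎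
  where
  open ≡-Reasoning
  distrib : ∀ a b x y → (a + b) * (x * y) ≡ a * x * y + x * (b * y)
  distrib = solve-∀ ℚ-ring
  split-weight : ∀ i → i < suc n →
    ℕ→ℚ n * (f i * g (n ∸ i)) ≡ ℕ→ℚ i * f i * g (n ∸ i) + f i * (ℕ→ℚ (n ∸ i) * g (n ∸ i))
  split-weight i (s≤s i≤n) = begin
    ℕ→ℚ n * (f i * g (n ∸ i))                 ≡⟨ cong (λ k → ℕ→ℚ k * (f i * g (n ∸ i))) (sym (ℕ.m+[n∸m]≡n i≤n)) ⟩
    ℕ→ℚ (i ℕ.+ (n ∸ i)) * (f i * g (n ∸ i))   ≡⟨ cong (_* (f i * g (n ∸ i))) (ℕ→ℚ-homo-+ i (n ∸ i)) ⟩
    (ℕ→ℚ i + ℕ→ℚ (n ∸ i)) * (f i * g (n ∸ i)) ≡⟨ distrib (ℕ→ℚ i) _ (f i) _ ⟩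
    ℕ→ℚ i * f i * g (n ∸ i) + f i * (ℕ→ℚ (n ∸ i) * g (n ∸ i)) ∎

θ²-⊛ : ∀ f g → θ (θ (f ⊛ g)) ≈ θ (θ f) ⊛ g ⊕ ⟨ 2 ⟩ ⊛ (θ f ⊛ θ g) ⊕ f ⊛ θ (θ g)
θ²-⊛ f g = begin
  θ (θ (f ⊛ g))                                               ≈⟨ θ-cong (θ-⊛ f g) ⟩
  θ (θ f ⊛ g ⊕ f ⊛ θ g)                                       ≈⟨ θ-⊕ (θ f ⊛ g) (f ⊛ θ g) ⟩
  θ (θ f ⊛ g) ⊕ θ (f ⊛ θ g)                                   ≈⟨ ⊕-cong (θ-⊛ (θ f) g) (θ-⊛ f (θ g)) ⟩
  θ (θ f) ⊛ g ⊕ θ f ⊛ θ g ⊕ (θ f ⊛ θ g ⊕ f ⊛ θ (θ g))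
    ≈⟨ solve 6 (λ ttf g tf tg f ttg → ttf :* g :+ tf :* tg :+ (tf :* tg :+ f :* ttg) := ttf :* g :+ κ 2 :* (tf :* tg) :+ f :* ttg)
               ≈-refl (θ (θ f)) g (θ f) (θ g) f (θ (θ g)) ⟩
  θ (θ f) ⊛ g ⊕ ⟨ 2 ⟩ ⊛ (θ f ⊛ θ g) ⊕ f ⊛ θ (θ g)            ∎
  where open ≈-Reasoning

θ≈X⊛D : ∀ f → θ f ≈ X ⊛ D f
θ≈X⊛D f zero    = trans (ℚ.*-zeroˡ (f 0)) (sym (X⊛-zero (D f)))
θ≈X⊛D f (suc n) = sym (X⊛-suc (D f) n)

θ-X : θ X ≈ X
θ-X zero          = refl
θ-X (suc zero)    = refl
θ-X (suc (suc n)) = ℚ.*-zeroʳ (ℕ→ℚ (suc (suc n)))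

θ≈0⇒const : ∀ f → θ f ≈ 0ˢ → f ≈ const (f 0)
θ≈0⇒const f θf≈0 zero    = refl
θ≈0⇒const f θf≈0 (suc n) = *≡0⇒≡0 (ℕ→ℚ-suc≢0 n) (θf≈0 (suc n))

θ-const⊛ : ∀ c f → θ (const c ⊛ f) ≈ const c ⊛ θ f
θ-const⊛ c f = ≈-trans (θ-cong (const-⊛ c f)) (≈-trans (θ-• c f) (•≈const⊛ c (θ f)))

OrderAtLeast : ℕ → Series → Set
OrderAtLeast k f = ∀ n → n < k → f n ≡ 0ℚ

sumBelow-single : ∀ {n j} (f : ℕ → ℚ) → j < n → (∀ i → i < n → i ≢ j → f i ≡ 0ℚ) →
                  sumBelow n f ≡ f j
sumBelow-single {suc n} {j} f j<1+n others with j ℕ.≟ n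
... | yes refl = trans (cong (_+ f n) (sumBelow-zero n (λ i i<n → others i (ℕ.m<n⇒m<1+n i<n) (ℕ.<⇒≢ i<n))))
                       (ℚ.+-identityˡ (f n))
... | no j≢n   = trans (cong₂ _+_ (sumBelow-single f (ℕ.≤∧≢⇒< (ℕ.≤-pred j<1+n) j≢n)
                                      (λ i i<n → others i (ℕ.m<n⇒m<1+n i<n)))
                                   (others n ℕ.≤-refl (j≢n ∘ sym)))
                       (ℚ.+-identityʳ (f j))

⊛-order : ∀ {a b f g} → OrderAtLeast a f → OrderAtLeast b g → OrderAtLeast (a ℕ.+ b) (f ⊛ g)
⊛-order {a} {b} {f} {g} f≥a g≥b n n<a+b = sumBelow-zero (suc n) term≡0
  where
  term≡0 : ∀ i → i < suc n → f i * g (n ∸ i) ≡ 0ℚ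
  term≡0 i (s≤s i≤n) with i ℕ.<? a
  ... | yes i<a = trans (cong (_* g (n ∸ i)) (f≥a i i<a)) (ℚ.*-zeroˡ (g (n ∸ i)))
  ... | no  i≮a = trans (cong (f i *_) (g≥b (n ∸ i) n∸i<b)) (ℚ.*-zeroʳ (f i))
    where
    n∸i<b : n ∸ i < b
    n∸i<b = ℕ.+-cancelʳ-< i (n ∸ i) b
      (subst (_< b ℕ.+ i) (sym (ℕ.m∸n+n≡m i≤n))
             (ℕ.<-≤-trans n<a+b (subst (a ℕ.+ b ≤_) (ℕ.+-comm i b) (ℕ.+-monoˡ-≤ b (ℕ.≮⇒≥ i≮a)))))

⊛-leading : ∀ {a b f g} → OrderAtLeast a f → OrderAtLeast b g → (f ⊛ g) (a ℕ.+ b) ≡ f a * g b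
⊛-leading {a} {b} {f} {g} f≥a g≥b =
  trans (sumBelow-single _ (s≤s (ℕ.m≤m+n a b)) others) (cong (λ k → f a * g k) (ℕ.m+n∸m≡n a b))
  where
  others : ∀ i → i < suc (a ℕ.+ b) → i ≢ a → f i * g (a ℕ.+ b ∸ i) ≡ 0ℚ
  others i (s≤s i≤a+b) i≢a with i ℕ.<? a
  ... | yes i<a = trans (cong (_* g (a ℕ.+ b ∸ i)) (f≥a i i<a)) (ℚ.*-zeroˡ (g (a ℕ.+ b ∸ i)))
  ... | no  i≮a = trans (cong (f i *_) (g≥b (a ℕ.+ b ∸ i) a+b∸i<b)) (ℚ.*-zeroʳ (f i))
    where
    a<i : a < i
    a<i = ℕ.≤∧≢⇒< (ℕ.≮⇒≥ i≮a) (i≢a ∘ sym)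
    a+b∸i<b : a ℕ.+ b ∸ i < b
    a+b∸i<b = ℕ.+-cancelʳ-< i (a ℕ.+ b ∸ i) b
      (subst (_< b ℕ.+ i) (sym (ℕ.m∸n+n≡m i≤a+b))
             (subst (_< b ℕ.+ i) (ℕ.+-comm b a) (ℕ.+-monoʳ-< b a<i)))

θ-order : ∀ {k f} → OrderAtLeast k f → OrderAtLeast k (θ f)
θ-order f≥k n n<k = trans (cong (ℕ→ℚ n *_) (f≥k n n<k)) (ℚ.*-zeroʳ (ℕ→ℚ n))

-- Composition

^ˢ-zero : ∀ g → g ^ˢ 0 ≈ 1ˢ
^ˢ-zero g zero    = refl
^ˢ-zero g (suc n) = refl

^ˢ-cong : ∀ {f g} → f ≈ g → ∀ k → f ^ˢ k ≈ g ^ˢ k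
^ˢ-cong {f} {g} f≈g zero    = ≈-trans (^ˢ-zero f) (≈-sym (^ˢ-zero g))
^ˢ-cong         f≈g (suc k) = ⊛-cong f≈g (^ˢ-cong f≈g k)

^ˢ-+ : ∀ g j k → (g ^ˢ j) ⊛ (g ^ˢ k) ≈ g ^ˢ (j ℕ.+ k)
^ˢ-+ g zero    k = ≈-trans (⊛-congʳ (g ^ˢ k) (^ˢ-zero g)) (⊛-identityˡ (g ^ˢ k))
^ˢ-+ g (suc j) k = ≈-trans (⊛-assoc g (g ^ˢ j) (g ^ˢ k)) (⊛-congˡ g (^ˢ-+ g j k))

∘-cong : ∀ {f f′} g → f ≈ f′ → f ∘ˢ g ≈ f′ ∘ˢ g
∘-cong g f≈f′ n = sumBelow-cong (suc n) (λ k _ → cong (_* (g ^ˢ k) n) (f≈f′ k))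

∘-⊕ : ∀ f f′ g → (f ⊕ f′) ∘ˢ g ≈ f ∘ˢ g ⊕ f′ ∘ˢ g
∘-⊕ f f′ g n = trans (sumBelow-cong (suc n) (λ k _ → ℚ.*-distribʳ-+ ((g ^ˢ k) n) (f k) (f′ k)))
                     (sumBelow-distrib-+ (suc n) _ _)

∘-• : ∀ c f g → (c • f) ∘ˢ g ≈ c • (f ∘ˢ g)
∘-• c f g n = trans (sumBelow-cong (suc n) (λ k _ → ℚ.*-assoc c (f k) _)) (sym (*-distribˡ-sumBelow (suc n) c _))

module Composition (g : Series) (g₀≡0 : g 0 ≡ 0ℚ) where

  ^ˢ-order : ∀ k → OrderAtLeast k (g ^ˢ k)
  ^ˢ-order zero    n ()
  ^ˢ-order (suc k) = ⊛-order {1} g-order (^ˢ-order k)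
    where
    g-order : OrderAtLeast 1 g
    g-order zero    _           = g₀≡0
    g-order (suc n) (s≤s ())

  ∘-truncate : ∀ f {n N} → n < N → (f ∘ˢ g) n ≡ sumBelow N (λ k → f k * (g ^ˢ k) n)
  ∘-truncate f {n} n<N = sym (sumBelow-extend _ n<N
    (λ k n<k → trans (cong (f k *_) (^ˢ-order k n n<k)) (ℚ.*-zeroʳ (f k))))

  ∘-⊛ʳ : ∀ f H n → ((f ∘ˢ g) ⊛ H) n ≡ sumBelow (suc n) (λ k → f k * ((g ^ˢ k) ⊛ H) n)
  ∘-⊛ʳ f H n = begin
    sumBelow (suc n) (λ i → (f ∘ˢ g) i * H (n ∸ i))
      ≡⟨ sumBelow-cong (suc n) (λ i i≤n → cong (_* H (n ∸ i)) (∘-truncate f i≤n)) ⟩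
    sumBelow (suc n) (λ i → sumBelow (suc n) (λ k → f k * (g ^ˢ k) i) * H (n ∸ i))
      ≡⟨ sumBelow-cong (suc n) (λ i _ → trans (*-distribʳ-sumBelow (suc n) (H (n ∸ i)) _)
                                         (sumBelow-cong (suc n) (λ k _ → ℚ.*-assoc (f k) _ _))) ⟩
    sumBelow (suc n) (λ i → sumBelow (suc n) (λ k → f k * ((g ^ˢ k) i * H (n ∸ i))))
      ≡⟨ sumBelow-swap (suc n) (suc n) _ ⟩
    sumBelow (suc n) (λ k → sumBelow (suc n) (λ i → f k * ((g ^ˢ k) i * H (n ∸ i))))
      ≡⟨ sumBelow-cong (suc n) (λ k _ → sym (*-distribˡ-sumBelow (suc n) (f k) _)) ⟩
    sumBelow (suc n) (λ k → f k * ((g ^ˢ k) ⊛ H) n) ∎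
    where open ≡-Reasoning

  ∘-⊛ : ∀ f f′ → (f ⊛ f′) ∘ˢ g ≈ (f ∘ˢ g) ⊛ (f′ ∘ˢ g)
  ∘-⊛ f f′ n = begin
    sumBelow (suc n) (λ m → sumBelow (suc m) (λ i → f i * f′ (m ∸ i)) * (g ^ˢ m) n)
      ≡⟨ sumBelow-cong (suc n) (λ m _ → *-distribʳ-sumBelow (suc m) _ _) ⟩
    sumBelow (suc n) (λ m → sumBelow (suc m) (λ i → f i * f′ (m ∸ i) * (g ^ˢ m) n))
      ≡⟨ sumBelow-triangle n _ ⟩
    sumBelow (suc n) (λ i → sumBelow (suc (n ∸ i)) (λ j → f i * f′ (i ℕ.+ j ∸ i) * (g ^ˢ (i ℕ.+ j)) n))
      ≡⟨ sumBelow-cong (suc n) (λ i i≤n → full-row i (ℕ.≤-pred i≤n)) ⟩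
    sumBelow (suc n) (λ i → f i * sumBelow (suc n) (λ j → f′ j * (g ^ˢ (j ℕ.+ i)) n))
      ≡⟨ sumBelow-cong (suc n) (λ i _ → cong (f i *_) (sym (inner i))) ⟩
    sumBelow (suc n) (λ i → f i * ((g ^ˢ i) ⊛ (f′ ∘ˢ g)) n)
      ≡⟨ sym (∘-⊛ʳ f (f′ ∘ˢ g) n) ⟩
    ((f ∘ˢ g) ⊛ (f′ ∘ˢ g)) n ∎
    where
    open ≡-Reasoning
    inner : ∀ i → ((g ^ˢ i) ⊛ (f′ ∘ˢ g)) n ≡ sumBelow (suc n) (λ j → f′ j * (g ^ˢ (j ℕ.+ i)) n)
    inner i = begin
      ((g ^ˢ i) ⊛ (f′ ∘ˢ g)) n                                 ≡⟨ ⊛-comm (g ^ˢ i) (f′ ∘ˢ g) n ⟩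
      ((f′ ∘ˢ g) ⊛ (g ^ˢ i)) n                                 ≡⟨ ∘-⊛ʳ f′ (g ^ˢ i) n ⟩
      sumBelow (suc n) (λ j → f′ j * ((g ^ˢ j) ⊛ (g ^ˢ i)) n)
        ≡⟨ sumBelow-cong (suc n) (λ j _ → cong (f′ j *_) (^ˢ-+ g j i n)) ⟩
      sumBelow (suc n) (λ j → f′ j * (g ^ˢ (j ℕ.+ i)) n)       ∎
    full-row : ∀ i → i ≤ n →
      sumBelow (suc (n ∸ i)) (λ j → f i * f′ (i ℕ.+ j ∸ i) * (g ^ˢ (i ℕ.+ j)) n) ≡
      f i * sumBelow (suc n) (λ j → f′ j * (g ^ˢ (j ℕ.+ i)) n)
    full-row i i≤n = begin
      sumBelow (suc (n ∸ i)) (λ j → f i * f′ (i ℕ.+ j ∸ i) * (g ^ˢ (i ℕ.+ j)) n)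
        ≡⟨ sumBelow-cong (suc (n ∸ i)) (λ j _ → regroup j) ⟩
      sumBelow (suc (n ∸ i)) (λ j → f i * (f′ j * (g ^ˢ (j ℕ.+ i)) n))
        ≡⟨ sumBelow-extend _ (s≤s (ℕ.m∸n≤m n i)) vanishing ⟨
      sumBelow (suc n) (λ j → f i * (f′ j * (g ^ˢ (j ℕ.+ i)) n))
        ≡⟨ sym (*-distribˡ-sumBelow (suc n) (f i) _) ⟩
      f i * sumBelow (suc n) (λ j → f′ j * (g ^ˢ (j ℕ.+ i)) n) ∎
      where
      regroup : ∀ j → f i * f′ (i ℕ.+ j ∸ i) * (g ^ˢ (i ℕ.+ j)) n ≡ f i * (f′ j * (g ^ˢ (j ℕ.+ i)) n)
      regroup j = trans (ℚ.*-assoc (f i) _ _)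
        (cong₂ (λ a b → f i * (f′ a * (g ^ˢ b) n)) (ℕ.m+n∸m≡n i j) (ℕ.+-comm i j))
      vanishing : ∀ j → suc (n ∸ i) ≤ j → f i * (f′ j * (g ^ˢ (j ℕ.+ i)) n) ≡ 0ℚ
      vanishing j n∸i<j = begin
        f i * (f′ j * (g ^ˢ (j ℕ.+ i)) n)  ≡⟨ cong (λ x → f i * (f′ j * x)) (^ˢ-order (j ℕ.+ i) n n<j+i) ⟩
        f i * (f′ j * 0ℚ)                  ≡⟨ trans (cong (f i *_) (ℚ.*-zeroʳ (f′ j))) (ℚ.*-zeroʳ (f i)) ⟩
        0ℚ                                 ∎
        where
        n<j+i : n < j ℕ.+ i
        n<j+i = subst (_< j ℕ.+ i) (ℕ.m∸n+n≡m i≤n) (ℕ.+-monoˡ-< i n∸i<j)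

  ∘-const : ∀ c → const c ∘ˢ g ≈ const c
  ∘-const c n = begin
    sumBelow (suc n) (λ k → const c k * (g ^ˢ k) n)
      ≡⟨ sumBelow-head n _ ⟩
    c * (g ^ˢ 0) n + sumBelow n (λ k → 0ℚ * (g ^ˢ suc k) n)
      ≡⟨ cong₂ _+_ (cong (c *_) (^ˢ-zero g n)) (sumBelow-zero n (λ k _ → ℚ.*-zeroˡ ((g ^ˢ suc k) n))) ⟩
    c * const 1ℚ n + 0ℚ
      ≡⟨ trans (ℚ.+-identityʳ _) (scale-1ˢ n) ⟩
    const c n ∎
    where
    open ≡-Reasoning
    scale-1ˢ : ∀ n → c * const 1ℚ n ≡ const c n
    scale-1ˢ zero    = ℚ.*-identityʳ c
    scale-1ˢ (suc n) = ℚ.*-zeroʳ c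

  ∘-X : X ∘ˢ g ≈ g
  ∘-X zero    = sym g₀≡0
  ∘-X (suc n) = begin
    sumBelow (suc (suc n)) (λ k → X k * (g ^ˢ k) (suc n))
      ≡⟨ sumBelow-head (suc n) _ ⟩
    0ℚ * (g ^ˢ 0) (suc n) + sumBelow (suc n) (λ k → X (suc k) * (g ^ˢ suc k) (suc n))
      ≡⟨ cong₂ _+_ (ℚ.*-zeroˡ ((g ^ˢ 0) (suc n))) (sumBelow-head n (λ k → X (suc k) * (g ^ˢ suc k) (suc n))) ⟩
    0ℚ + (1ℚ * (g ⊛ g ^ˢ 0) (suc n) + sumBelow n (λ k → 0ℚ * (g ^ˢ suc (suc k)) (suc n)))
      ≡⟨ cong (λ s → 0ℚ + (1ℚ * (g ⊛ g ^ˢ 0) (suc n) + s))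
              (sumBelow-zero n (λ k _ → ℚ.*-zeroˡ ((g ^ˢ suc (suc k)) (suc n)))) ⟩
    0ℚ + (1ℚ * (g ⊛ g ^ˢ 0) (suc n) + 0ℚ)
      ≡⟨ trans (ℚ.+-identityˡ _) (trans (ℚ.+-identityʳ _) (ℚ.*-identityˡ _)) ⟩
    (g ⊛ g ^ˢ 0) (suc n)
      ≡⟨ ⊛-congˡ g (^ˢ-zero g) (suc n) ⟩
    (g ⊛ 1ˢ) (suc n)
      ≡⟨ ⊛-comm g 1ˢ (suc n) ⟩
    (1ˢ ⊛ g) (suc n)
      ≡⟨ ⊛-identityˡ g (suc n) ⟩
    g (suc n) ∎
    where open ≡-Reasoning

  θ-^ˢ : ∀ k → θ (g ^ˢ suc k) ≈ const (ℕ→ℚ (suc k)) ⊛ (g ^ˢ k ⊛ θ g)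
  θ-^ˢ zero = begin
    θ (g ⊛ g ^ˢ 0)                    ≈⟨ θ-⊛ g (g ^ˢ 0) ⟩
    θ g ⊛ g ^ˢ 0 ⊕ g ⊛ θ (g ^ˢ 0)     ≈⟨ ⊕-congˡ (θ g ⊛ g ^ˢ 0) (⊛-vanishes g θg⁰≈0) ⟩
    θ g ⊛ g ^ˢ 0 ⊕ 0ˢ                 ≈⟨ (λ n → ℚ.+-identityʳ _) ⟩
    θ g ⊛ g ^ˢ 0                      ≈⟨ ⊛-comm (θ g) (g ^ˢ 0) ⟩
    g ^ˢ 0 ⊛ θ g                      ≈⟨ ⊛-identityˡ (g ^ˢ 0 ⊛ θ g) ⟨
    1ˢ ⊛ (g ^ˢ 0 ⊛ θ g)               ∎
    where
    open ≈-Reasoning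
    θg⁰≈0 : θ (g ^ˢ 0) ≈ 0ˢ
    θg⁰≈0 = ≈-trans (θ-cong (^ˢ-zero g)) (θ-const 1ℚ)
  θ-^ˢ (suc k) = begin
    θ (g ⊛ g ^ˢ suc k)
      ≈⟨ θ-⊛ g (g ^ˢ suc k) ⟩
    θ g ⊛ g ^ˢ suc k ⊕ g ⊛ θ (g ^ˢ suc k)
      ≈⟨ ⊕-congˡ (θ g ⊛ g ^ˢ suc k) (⊛-congˡ g (θ-^ˢ k)) ⟩
    θ g ⊛ (g ⊛ g ^ˢ k) ⊕ g ⊛ (const m ⊛ (g ^ˢ k ⊛ θ g))
      ≈⟨ solve 4 (λ tg x xk c → tg :* (x :* xk) :+ x :* (c :* (xk :* tg)) := (κ 1 :+ c) :* (x :* xk :* tg))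
                 ≈-refl (θ g) g (g ^ˢ k) (const m) ⟩
    (1ˢ ⊕ const m) ⊛ (g ^ˢ suc k ⊛ θ g)
      ≈⟨ ⊛-congʳ (g ^ˢ suc k ⊛ θ g) (≈-trans (const-cong (ℕ→ℚ-homo-+ 1 (suc k))) (const-homo-+ 1ℚ m)) ⟨
    const (ℕ→ℚ (suc (suc k))) ⊛ (g ^ˢ suc k ⊛ θ g) ∎
    where
    open ≈-Reasoning
    m : ℚ
    m = ℕ→ℚ (suc k)

  chain-rule : ∀ f → θ (f ∘ˢ g) ≈ (D f ∘ˢ g) ⊛ θ g
  chain-rule f n = begin
    ℕ→ℚ n * sumBelow (suc n) (λ k → f k * (g ^ˢ k) n)
      ≡⟨ trans (*-distribˡ-sumBelow (suc n) (ℕ→ℚ n) _)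
               (sumBelow-cong (suc n) (λ k _ → swap-scalar (ℕ→ℚ n) (f k) _)) ⟩
    sumBelow (suc n) (λ k → f k * θ (g ^ˢ k) n)
      ≡⟨ sumBelow-head n _ ⟩
    f 0 * θ (g ^ˢ 0) n + sumBelow n (λ k → f (suc k) * θ (g ^ˢ suc k) n)
      ≡⟨ cong₂ _+_ constant-term (sumBelow-cong n (λ k _ → power-term k)) ⟩
    0ℚ + sumBelow n (λ k → D f k * (g ^ˢ k ⊛ θ g) n)
      ≡⟨ ℚ.+-identityˡ _ ⟩
    sumBelow n (λ k → D f k * (g ^ˢ k ⊛ θ g) n)
      ≡⟨ sumBelow-extend _ (ℕ.n≤1+n n)
                         (λ k n≤k → trans (cong (D f k *_) (too-high k n≤k)) (ℚ.*-zeroʳ (D f k))) ⟨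
    sumBelow (suc n) (λ k → D f k * (g ^ˢ k ⊛ θ g) n)
      ≡⟨ ∘-⊛ʳ (D f) (θ g) n ⟨
    ((D f ∘ˢ g) ⊛ θ g) n ∎
    where
    open ≡-Reasoning
    swap-scalar : ∀ m a x → m * (a * x) ≡ a * (m * x)
    swap-scalar = solve-∀ ℚ-ring
    regroup : ∀ a m x → a * (m * x) ≡ m * a * x
    regroup = solve-∀ ℚ-ring
    constant-term : f 0 * θ (g ^ˢ 0) n ≡ 0ℚ
    constant-term = trans (cong (f 0 *_) (≈-trans (θ-cong (^ˢ-zero g)) (θ-const 1ℚ) n)) (ℚ.*-zeroʳ (f 0))
    power-term : ∀ k → f (suc k) * θ (g ^ˢ suc k) n ≡ D f k * (g ^ˢ k ⊛ θ g) n
    power-term k = trans (cong (f (suc k) *_) (trans (θ-^ˢ k n) (const-⊛ (ℕ→ℚ (suc k)) (g ^ˢ k ⊛ θ g) n)))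
                         (regroup (f (suc k)) (ℕ→ℚ (suc k)) _)
    θg-order : OrderAtLeast 1 (θ g)
    θg-order zero    _        = trans (cong (0ℚ *_) g₀≡0) (ℚ.*-zeroˡ 0ℚ)
    θg-order (suc _) (s≤s ())
    too-high : ∀ k → n ≤ k → (g ^ˢ k ⊛ θ g) n ≡ 0ℚ
    too-high k n≤k = ⊛-order (^ˢ-order k) θg-order n (subst (n <_) (ℕ.+-comm 1 k) (s≤s n≤k))

  chain-rule² : ∀ f → θ (θ (f ∘ˢ g)) ≈ (D (D f) ∘ˢ g) ⊛ θ g ⊛ θ g ⊕ (D f ∘ˢ g) ⊛ θ (θ g)
  chain-rule² f = begin
    θ (θ (f ∘ˢ g))                                      ≈⟨ θ-cong (chain-rule f) ⟩
    θ ((D f ∘ˢ g) ⊛ θ g)                                ≈⟨ θ-⊛ (D f ∘ˢ g) (θ g) ⟩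
    θ (D f ∘ˢ g) ⊛ θ g ⊕ (D f ∘ˢ g) ⊛ θ (θ g)
      ≈⟨ ⊕-congʳ ((D f ∘ˢ g) ⊛ θ (θ g)) (⊛-congʳ (θ g) (chain-rule (D f))) ⟩
    (D (D f) ∘ˢ g) ⊛ θ g ⊛ θ g ⊕ (D f ∘ˢ g) ⊛ θ (θ g)   ∎
    where open ≈-Reasoning

D-binomSeries : ∀ α k → D (binomSeries α) k ≡ binomSeries α k * (α - ℕ→ℚ k)
D-binomSeries α k = begin
  ℕ→ℚ (suc k) * (b k * (α - ℕ→ℚ k) * (ℤ.+ 1 / suc k))  ≡⟨ rearrange (ℕ→ℚ (suc k)) (b k * (α - ℕ→ℚ k)) _ ⟩
  b k * (α - ℕ→ℚ k) * (ℕ→ℚ (suc k) * (ℤ.+ 1 / suc k))  ≡⟨ cong (b k * (α - ℕ→ℚ k) *_) (ℕ→ℚ-*-reciprocal k) ⟩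
  b k * (α - ℕ→ℚ k) * 1ℚ                               ≡⟨ ℚ.*-identityʳ _ ⟩
  b k * (α - ℕ→ℚ k)                                    ∎
  where
  open ≡-Reasoning
  b : Series
  b = binomSeries α
  rearrange : ∀ m x r → m * (x * r) ≡ x * (m * r)
  rearrange = solve-∀ ℚ-ring

binomSeries-ode : ∀ α → (1ˢ ⊕ X) ⊛ D (binomSeries α) ≈ α • binomSeries α
binomSeries-ode α n = begin
  ((1ˢ ⊕ X) ⊛ D b) n          ≡⟨ ⊛-comm (1ˢ ⊕ X) (D b) n ⟩
  (D b ⊛ (1ˢ ⊕ X)) n          ≡⟨ ⊛-distribˡ-⊕ (D b) 1ˢ X n ⟩
  (D b ⊛ 1ˢ) n + (D b ⊛ X) n  ≡⟨ cong₂ _+_ (trans (⊛-comm (D b) 1ˢ n) (⊛-identityˡ (D b) n)) (⊛-comm (D b) X n) ⟩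
  D b n + (X ⊛ D b) n         ≡⟨ pointwise n ⟩
  α * b n                     ∎
  where
  open ≡-Reasoning
  b : Series
  b = binomSeries α
  at-zero : ∀ α → 1ℚ * (α - 0ℚ) + 0ℚ ≡ α * 1ℚ
  at-zero = solve-∀ ℚ-ring
  at-suc : ∀ x α m → x * (α - m) + m * x ≡ α * x
  at-suc = solve-∀ ℚ-ring
  pointwise : ∀ n → D b n + (X ⊛ D b) n ≡ α * b n
  pointwise zero    = begin
    D b 0 + (X ⊛ D b) 0  ≡⟨ cong₂ _+_ (D-binomSeries α 0) (X⊛-zero (D b)) ⟩
    1ℚ * (α - 0ℚ) + 0ℚ   ≡⟨ at-zero α ⟩
    α * 1ℚ               ∎
  pointwise (suc m) = begin
    D b (suc m) + (X ⊛ D b) (suc m)                         ≡⟨ cong₂ _+_ (D-binomSeries α (suc m)) (X⊛-suc (D b) m) ⟩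
    b (suc m) * (α - ℕ→ℚ (suc m)) + ℕ→ℚ (suc m) * b (suc m) ≡⟨ at-suc (b (suc m)) α (ℕ→ℚ (suc m)) ⟩
    α * b (suc m)                                           ∎

A≈25[1+U] : A ≈ const (ℕ→ℚ 25) ⊛ (1ˢ ⊕ U)
A≈25[1+U] n = trans (pointwise n) (sym (const-⊛ (ℕ→ℚ 25) (1ˢ ⊕ U) n))
  where
  unscale : ∀ a → a ≡ ℕ→ℚ 25 * (0ℚ + ℤ.+ 1 / 25 * a)
  unscale = solve-∀ ℚ-ring
  pointwise : ∀ n → A n ≡ ℕ→ℚ 25 * (1ˢ ⊕ U) n
  pointwise zero    = refl
  pointwise (suc n) = unscale (A (suc n))

θA≈25θU : θ A ≈ const (ℕ→ℚ 25) ⊛ θ U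
θA≈25θU n = trans (pointwise n) (sym (const-⊛ (ℕ→ℚ 25) (θ U) n))
  where
  unscale : ∀ m a → m * a ≡ ℕ→ℚ 25 * (m * (ℤ.+ 1 / 25 * a))
  unscale = solve-∀ ℚ-ring
  pointwise : ∀ n → θ A n ≡ ℕ→ℚ 25 * θ U n
  pointwise zero    = refl
  pointwise (suc n) = unscale (ℕ→ℚ (suc n)) (A (suc n))

-- c • (binomSeries α ∘ˢ U) is a constant multiple of A^α, as A = 25 (1 + U).
A-power-law : ∀ α c →
  A ⊛ θ (c • (binomSeries α ∘ˢ U)) ≈ α • ((c • (binomSeries α ∘ˢ U)) ⊛ θ A)
A-power-law α c = begin
  A ⊛ θ (c • bU)
    ≈⟨ ⊛-cong A≈25[1+U] (≈-trans (θ-• c bU) (≈-trans (•≈const⊛ c (θ bU)) (⊛-congˡ (const c) (chain-rule b)))) ⟩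
  const (ℕ→ℚ 25) ⊛ (1ˢ ⊕ U) ⊛ (const c ⊛ ((D b ∘ˢ U) ⊛ θ U))
    ≈⟨ solve 5 (λ k c u db tu → k :* (κ 1 :+ u) :* (c :* (db :* tu)) := k :* c :* ((κ 1 :+ u) :* db) :* tu) ≈-refl
         (const (ℕ→ℚ 25)) (const c) U (D b ∘ˢ U) (θ U) ⟩
  const (ℕ→ℚ 25) ⊛ const c ⊛ ((1ˢ ⊕ U) ⊛ (D b ∘ˢ U)) ⊛ θ U
    ≈⟨ ⊛-congʳ (θ U) (⊛-congˡ (const (ℕ→ℚ 25) ⊛ const c) ode-along-U) ⟩
  const (ℕ→ℚ 25) ⊛ const c ⊛ (const α ⊛ bU) ⊛ θ U
    ≈⟨ solve 5 (λ k c a x tu → k :* c :* (a :* x) :* tu := a :* (c :* x :* (k :* tu))) ≈-refl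
         (const (ℕ→ℚ 25)) (const c) (const α) bU (θ U) ⟩
  const α ⊛ (const c ⊛ bU ⊛ (const (ℕ→ℚ 25) ⊛ θ U))
    ≈⟨ ≈-trans (•≈const⊛ α _) (⊛-congˡ (const α) (⊛-cong (•≈const⊛ c bU) θA≈25θU)) ⟨
  α • ((c • bU) ⊛ θ A) ∎
  where
  open ≈-Reasoning
  open Composition U refl
  b bU : Series
  b = binomSeries α
  bU = b ∘ˢ U
  ode-along-U : (1ˢ ⊕ U) ⊛ (D b ∘ˢ U) ≈ const α ⊛ bU
  ode-along-U = begin
    (1ˢ ⊕ U) ⊛ (D b ∘ˢ U)                 ≈⟨ ⊛-congʳ (D b ∘ˢ U) (⊕-cong (∘-const 1ℚ) ∘-X) ⟨
    (1ˢ ∘ˢ U ⊕ X ∘ˢ U) ⊛ (D b ∘ˢ U)       ≈⟨ ⊛-congʳ (D b ∘ˢ U) (∘-⊕ 1ˢ X U) ⟨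
    ((1ˢ ⊕ X) ∘ˢ U) ⊛ (D b ∘ˢ U)          ≈⟨ ∘-⊛ (1ˢ ⊕ X) (D b) ⟨
    ((1ˢ ⊕ X) ⊛ D b) ∘ˢ U                 ≈⟨ ∘-cong U (binomSeries-ode α) ⟩
    (α • b) ∘ˢ U                          ≈⟨ ∘-• α b U ⟩
    α • bU                                ≈⟨ •≈const⊛ α bU ⟩
    const α ⊛ bU                          ∎

A⊛Ainv≈1 : A ⊛ Ainv ≈ 1ˢ
A⊛Ainv≈1 = θ≈0⇒const (A ⊛ Ainv) θ[A⊛Ainv]≈0
  where
  cancel : ∀ x → x + - 1ℚ * x ≡ 0ℚ
  cancel = solve-∀ ℚ-ring
  θ[A⊛Ainv]≈0 : θ (A ⊛ Ainv) ≈ 0ˢ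
  θ[A⊛Ainv]≈0 n = begin
    θ (A ⊛ Ainv) n                                 ≡⟨ θ-⊛ A Ainv n ⟩
    (θ A ⊛ Ainv) n + (A ⊛ θ Ainv) n                 ≡⟨ cong ((θ A ⊛ Ainv) n +_) (A-power-law (- 1ℚ) (ℤ.+ 1 / 25) n) ⟩
    (θ A ⊛ Ainv) n + - 1ℚ * (Ainv ⊛ θ A) n          ≡⟨ cong (λ y → (θ A ⊛ Ainv) n + - 1ℚ * y) (⊛-comm Ainv (θ A) n) ⟩
    (θ A ⊛ Ainv) n + - 1ℚ * (θ A ⊛ Ainv) n          ≡⟨ cancel ((θ A ⊛ Ainv) n) ⟩
    0ℚ                                             ∎
    where open ≡-Reasoning

two-A-θAinvSqrt : ⟨ 2 ⟩ ⊛ (A ⊛ θ AinvSqrt) ≈ ⊝ (AinvSqrt ⊛ θ A)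
two-A-θAinvSqrt n = begin
  (⟨ 2 ⟩ ⊛ (A ⊛ θ AinvSqrt)) n
    ≡⟨ const-⊛ _ (A ⊛ θ AinvSqrt) n ⟩
  ℤ→ℚ (ℤ.+ 2) * (A ⊛ θ AinvSqrt) n
    ≡⟨ cong (ℤ→ℚ (ℤ.+ 2) *_) (A-power-law (- (ℤ.+ 1 / 2)) (ℤ.+ 1 / 5) n) ⟩
  ℤ→ℚ (ℤ.+ 2) * (- (ℤ.+ 1 / 2) * (AinvSqrt ⊛ θ A) n)
    ≡⟨ halve _ ⟩
  - (AinvSqrt ⊛ θ A) n ∎
  where
  open ≡-Reasoning
  halve : ∀ x → ℤ→ℚ (ℤ.+ 2) * (- (ℤ.+ 1 / 2) * x) ≡ - x
  halve = solve-∀ ℚ-ring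

⟨suc⟩⊛-cancel : ∀ k f → ⟨ suc k ⟩ ⊛ f ≈ 0ˢ → f ≈ 0ˢ
⟨suc⟩⊛-cancel k f kf≈0 n = *≡0⇒≡0 (ℕ→ℚ-suc≢0 k) (trans (sym (const-⊛ _ f n)) (kf≈0 n))

A⊛-cancel : ∀ f → A ⊛ f ≈ 0ˢ → f ≈ 0ˢ
A⊛-cancel f Af≈0 = begin
  f                   ≈⟨ ⊛-identityˡ f ⟨
  1ˢ ⊛ f              ≈⟨ ⊛-congʳ f (≈-trans (⊛-comm Ainv A) A⊛Ainv≈1) ⟨
  Ainv ⊛ A ⊛ f        ≈⟨ ⊛-assoc Ainv A f ⟩
  Ainv ⊛ (A ⊛ f)      ≈⟨ ⊛-vanishes Ainv Af≈0 ⟩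
  0ˢ                  ∎
  where open ≈-Reasoning

-- Polynomial identities by comparing coefficients

poly : List ℤ → Series
poly []       _       = 0ℚ
poly (a ∷ as) zero    = ℤ→ℚ a
poly (a ∷ as) (suc n) = poly as n

poly-∷ : ∀ a as → poly (a ∷ as) ≈ fromℤ a ⊕ X ⊛ poly as
poly-∷ a as zero    = sym (trans (cong (ℤ→ℚ a +_) (X⊛-zero (poly as))) (ℚ.+-identityʳ _))
poly-∷ a as (suc n) = sym (trans (cong (0ℚ +_) (X⊛-suc (poly as) n)) (ℚ.+-identityˡ _))

infixl 6 _+ᶜ_
infixl 7 _*ᶜ_

_+ᶜ_ : List ℤ → List ℤ → List ℤ
[]       +ᶜ bs       = bs
(a ∷ as) +ᶜ []       = a ∷ as
(a ∷ as) +ᶜ (b ∷ bs) = a ℤ.+ b ∷ as +ᶜ bs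

-ᶜ_ : List ℤ → List ℤ
-ᶜ_ = List.map (λ a → ℤ.- a)

_*ᶜ_ : List ℤ → List ℤ → List ℤ
[]       *ᶜ bs = []
(a ∷ as) *ᶜ bs = List.map (a ℤ.*_) bs +ᶜ (ℤ.+ 0 ∷ as *ᶜ bs)

θᶜ-from : ℕ → List ℤ → List ℤ
θᶜ-from k []       = []
θᶜ-from k (a ∷ as) = ℤ.+ k ℤ.* a ∷ θᶜ-from (suc k) as

θᶜ : List ℤ → List ℤ
θᶜ = θᶜ-from 0

poly-+ : ∀ as bs → poly (as +ᶜ bs) ≈ poly as ⊕ poly bs
poly-+ []       bs       n       = sym (ℚ.+-identityˡ _)
poly-+ (a ∷ as) []       n       = sym (ℚ.+-identityʳ _)
poly-+ (a ∷ as) (b ∷ bs) zero    = ℤ→ℚ-homo-+ a b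
poly-+ (a ∷ as) (b ∷ bs) (suc n) = poly-+ as bs n

poly-neg : ∀ as → poly (-ᶜ as) ≈ ⊝ poly as
poly-neg []       n       = refl
poly-neg (a ∷ as) zero    = ℤ→ℚ-homo‿- a
poly-neg (a ∷ as) (suc n) = poly-neg as n

poly-scale : ∀ a bs → poly (List.map (a ℤ.*_) bs) ≈ fromℤ a ⊛ poly bs
poly-scale a bs n = trans (pointwise bs n) (sym (const-⊛ (ℤ→ℚ a) (poly bs) n))
  where
  pointwise : ∀ bs n → poly (List.map (a ℤ.*_) bs) n ≡ ℤ→ℚ a * poly bs n
  pointwise []       n       = sym (ℚ.*-zeroʳ (ℤ→ℚ a))
  pointwise (b ∷ bs) zero    = ℤ→ℚ-homo-* a b
  pointwise (b ∷ bs) (suc n) = pointwise bs n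

poly-* : ∀ as bs → poly (as *ᶜ bs) ≈ poly as ⊛ poly bs
poly-* []       bs n = sym (sumBelow-zero (suc n) (λ i _ → ℚ.*-zeroˡ (poly bs (n ∸ i))))
poly-* (a ∷ as) bs = begin
  poly (List.map (a ℤ.*_) bs +ᶜ (ℤ.+ 0 ∷ as *ᶜ bs))      ≈⟨ poly-+ (List.map (a ℤ.*_) bs) (ℤ.+ 0 ∷ as *ᶜ bs) ⟩
  poly (List.map (a ℤ.*_) bs) ⊕ poly (ℤ.+ 0 ∷ as *ᶜ bs)
    ≈⟨ ⊕-cong (poly-scale a bs) (≈-trans (poly-∷ _ _) (⊕-congˡ ⟨ 0 ⟩ (⊛-congˡ X (poly-* as bs)))) ⟩
  fromℤ a ⊛ poly bs ⊕ (⟨ 0 ⟩ ⊕ X ⊛ (poly as ⊛ poly bs))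
    ≈⟨ solve 4 (λ a q x p → a :* q :+ (κ 0 :+ x :* (p :* q)) := (a :+ x :* p) :* q) ≈-refl (fromℤ a) (poly bs) X (poly as) ⟩
  (fromℤ a ⊕ X ⊛ poly as) ⊛ poly bs                        ≈⟨ ⊛-congʳ (poly bs) (poly-∷ a as) ⟨
  poly (a ∷ as) ⊛ poly bs                                  ∎
  where open ≈-Reasoning

poly-θᶜ-from : ∀ k as n → poly (θᶜ-from k as) n ≡ ℕ→ℚ (k ℕ.+ n) * poly as n
poly-θᶜ-from k []       n       = sym (ℚ.*-zeroʳ (ℕ→ℚ (k ℕ.+ n)))
poly-θᶜ-from k (a ∷ as) zero    = trans (ℤ→ℚ-homo-* (ℤ.+ k) a) (cong (λ j → ℕ→ℚ j * ℤ→ℚ a) (sym (ℕ.+-identityʳ k)))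
poly-θᶜ-from k (a ∷ as) (suc n) = trans (poly-θᶜ-from (suc k) as n) (cong (λ j → ℕ→ℚ j * poly as n) (sym (ℕ.+-suc k n)))

poly-θ : ∀ as → poly (θᶜ as) ≈ θ (poly as)
poly-θ = poly-θᶜ-from 0

infixr 5 _∷⁰_

_∷⁰_ : ℤ → List ℤ → List ℤ
ℤ.+ 0 ∷⁰ [] = []
a     ∷⁰ as = a ∷ as

strip : List ℤ → List ℤ
strip []       = []
strip (a ∷ as) = a ∷⁰ strip as

poly-∷⁰ : ∀ a as → poly (a ∷⁰ as) ≈ poly (a ∷ as)
poly-∷⁰ (ℤ.+ 0)      []      zero    = refl
poly-∷⁰ (ℤ.+ 0)      []      (suc n) = refl
poly-∷⁰ (ℤ.+ 0)      (_ ∷ _) n       = refl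
poly-∷⁰ ℤ.+[1+ _ ]   _       n       = refl
poly-∷⁰ ℤ.-[1+ _ ]   _       n       = refl

poly-strip : ∀ as → poly (strip as) ≈ poly as
poly-strip []       n       = refl
poly-strip (a ∷ as) n       = trans (poly-∷⁰ a (strip as) n) (tail n)
  where
  tail : ∀ n → poly (a ∷ strip as) n ≡ poly (a ∷ as) n
  tail zero    = refl
  tail (suc n) = poly-strip as n

_^ᶜ_ : List ℤ → ℕ → List ℤ
as ^ᶜ zero  = ℤ.+ 1 ∷ []
as ^ᶜ suc k = as *ᶜ as ^ᶜ k

poly-^ : ∀ as k → poly (as ^ᶜ k) ≈ poly as ^ˢ k
poly-^ as zero    zero    = refl
poly-^ as zero    (suc n) = refl
poly-^ as (suc k) = ≈-trans (poly-* as (as ^ᶜ k)) (⊛-congˡ (poly as) (poly-^ as k))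

infixl 6 _‵+_ _‵-_
infixl 7 _‵*_
infixr 8 _‵^_

data PolyExpr : Set where
  ‵X ‵A        : PolyExpr
  ‵_           : ℕ → PolyExpr
  _‵+_ _‵-_ _‵*_ : PolyExpr → PolyExpr → PolyExpr
  ‵θ           : PolyExpr → PolyExpr
  _‵^_         : PolyExpr → ℕ → PolyExpr

⟦_⟧ : PolyExpr → Series
⟦ ‵X ⟧     = X
⟦ ‵A ⟧     = A
⟦ ‵ n ⟧    = ⟨ n ⟩
⟦ e ‵+ f ⟧ = ⟦ e ⟧ ⊕ ⟦ f ⟧
⟦ e ‵- f ⟧ = ⟦ e ⟧ ⊕ ⊝ ⟦ f ⟧
⟦ e ‵* f ⟧ = ⟦ e ⟧ ⊛ ⟦ f ⟧
⟦ ‵θ e ⟧   = θ ⟦ e ⟧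
⟦ e ‵^ k ⟧ = ⟦ e ⟧ ^ˢ k

coefficients : PolyExpr → List ℤ
coefficients ‵X       = List.map ℤ.+_ (0 ∷ 1 ∷ [])
coefficients ‵A       = List.map ℤ.+_ (25 ∷ 25 ∷ 15 ∷ 5 ∷ 1 ∷ [])
coefficients (‵ n)    = ℤ.+ n ∷ []
coefficients (e ‵+ f) = coefficients e +ᶜ coefficients f
coefficients (e ‵- f) = coefficients e +ᶜ -ᶜ coefficients f
coefficients (e ‵* f) = coefficients e *ᶜ coefficients f
coefficients (‵θ e)   = θᶜ (coefficients e)
coefficients (e ‵^ k) = coefficients e ^ᶜ k

X≈poly : X ≈ poly (coefficients ‵X)
X≈poly zero          = refl
X≈poly (suc zero)    = refl
X≈poly (suc (suc n)) = refl

A≈poly : A ≈ poly (coefficients ‵A)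
A≈poly 0 = refl
A≈poly 1 = refl
A≈poly 2 = refl
A≈poly 3 = refl
A≈poly 4 = refl
A≈poly (suc (suc (suc (suc (suc n))))) = refl

const≈poly : ∀ a → fromℤ a ≈ poly (a ∷ [])
const≈poly a zero    = refl
const≈poly a (suc n) = refl

⟦⟧≈poly : ∀ e → ⟦ e ⟧ ≈ poly (coefficients e)
⟦⟧≈poly ‵X       = X≈poly
⟦⟧≈poly ‵A       = A≈poly
⟦⟧≈poly (‵ n)    = const≈poly (ℤ.+ n)
⟦⟧≈poly (e ‵+ f) = ≈-trans (⊕-cong (⟦⟧≈poly e) (⟦⟧≈poly f)) (≈-sym (poly-+ (coefficients e) (coefficients f)))
⟦⟧≈poly (e ‵- f) = ≈-trans (⊕-cong (⟦⟧≈poly e) (⊝-cong (⟦⟧≈poly f)))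
  (≈-sym (≈-trans (poly-+ (coefficients e) (-ᶜ coefficients f)) (⊕-congˡ (poly (coefficients e)) (poly-neg (coefficients f)))))
⟦⟧≈poly (e ‵* f) = ≈-trans (⊛-cong (⟦⟧≈poly e) (⟦⟧≈poly f)) (≈-sym (poly-* (coefficients e) (coefficients f)))
⟦⟧≈poly (‵θ e)   = ≈-trans (θ-cong (⟦⟧≈poly e)) (≈-sym (poly-θ (coefficients e)))
⟦⟧≈poly (e ‵^ k) = ≈-trans (^ˢ-cong (⟦⟧≈poly e) k) (≈-sym (poly-^ (coefficients e) k))

≈-by-coefficients : ∀ e f → strip (coefficients e) ≡ strip (coefficients f) → ⟦ e ⟧ ≈ ⟦ f ⟧
≈-by-coefficients e f same = begin
  ⟦ e ⟧                       ≈⟨ ⟦⟧≈poly e ⟩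
  poly (coefficients e)       ≈⟨ poly-strip (coefficients e) ⟨
  poly (strip (coefficients e)) ≡⟨ cong poly same ⟩
  poly (strip (coefficients f)) ≈⟨ poly-strip (coefficients f) ⟩
  poly (coefficients f)       ≈⟨ ⟦⟧≈poly f ⟨
  ⟦ f ⟧                       ∎
  where open ≈-Reasoning

-- The differential equation of h5

quadratic : ℕ → ℕ → ℕ → Series → Series
quadratic a b c z = ⟨ a ⟩ ⊕ ⟨ b ⟩ ⊛ z ⊕ ⟨ c ⟩ ⊛ z ⊛ z

quadratic′ : ∀ {m} → ℕ → ℕ → ℕ → Polynomial m → Polynomial m
quadratic′ a b c z = κ a :+ κ b :* z :+ κ c :* z :* z

h5-ode : Series → Series → Series → Series → Series
h5-ode z y₀ y₁ y₂ = z ⊛ quadratic 500 88 4 z ⊛ y₂ ⊕ quadratic 500 132 8 z ⊛ y₁ ⊕ quadratic 10 1 0 z ⊛ y₀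

-- The recurrence for the coefficients of h5, written with θ.
h5-θ-ode : Series → Series
h5-θ-ode h = ⟨ 500 ⟩ ⊛ θ (θ h)
           ⊕ X ⊛ (⟨ 88 ⟩ ⊛ θ (θ h) ⊕ ⟨ 44 ⟩ ⊛ θ h ⊕ ⟨ 10 ⟩ ⊛ h)
           ⊕ X ⊛ (X ⊛ (⟨ 4 ⟩ ⊛ θ (θ h) ⊕ ⟨ 4 ⟩ ⊛ θ h ⊕ h))

cnext-recurrence : ∀ m p q →
  let M = ℕ→ℚ m; M₁ = ℕ→ℚ (suc m) in
  ℕ→ℚ 500 * (M₁ * (M₁ * cnext m p q))
  + (ℕ→ℚ 88 * (M * (M * q)) + ℕ→ℚ 44 * (M * q) + ℕ→ℚ 10 * q)
  + (ℕ→ℚ 2 * M - 1ℚ) * (ℕ→ℚ 2 * M - 1ℚ) * p ≡ 0ℚ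
cnext-recurrence m p q = begin
  c + (ℕ→ℚ 88 * (M * (M * q)) + ℕ→ℚ 44 * (M * q) + ℕ→ℚ 10 * q) + (ℕ→ℚ 2 * M - 1ℚ) * (ℕ→ℚ 2 * M - 1ℚ) * p
    ≡⟨ collect c M p q ⟩
  ℕ→ℚ 500 * (M₁ * (M₁ * - (ℤ.+ 1 / 500 * r * r * E))) + E
    ≡⟨ factor M₁ r E ⟩
  E + - (ℕ→ℚ 500 * (ℤ.+ 1 / 500) * (M₁ * r) * (M₁ * r) * E)
    ≡⟨ cong (λ x → E + - (ℕ→ℚ 500 * (ℤ.+ 1 / 500) * x * x * E)) (ℕ→ℚ-*-reciprocal m) ⟩
  E + - (1ℚ * 1ℚ * 1ℚ * E)
    ≡⟨ cancel E ⟩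
  0ℚ ∎
  where
  open ≡-Reasoning
  M M₁ r c E : ℚ
  M  = ℕ→ℚ m
  M₁ = ℕ→ℚ (suc m)
  r  = ℤ.+ 1 / suc m
  c  = ℕ→ℚ 500 * (M₁ * (M₁ * cnext m p q))
  E  = (ℕ→ℚ 2 * M - 1ℚ) * (ℕ→ℚ 2 * M - 1ℚ) * p + ℕ→ℚ 2 * (ℕ→ℚ 44 * M * M + ℕ→ℚ 22 * M + ℕ→ℚ 5) * q
  collect : ∀ c M p q →
    c + (ℕ→ℚ 88 * (M * (M * q)) + ℕ→ℚ 44 * (M * q) + ℕ→ℚ 10 * q) + (ℕ→ℚ 2 * M - 1ℚ) * (ℕ→ℚ 2 * M - 1ℚ) * p
    ≡ c + ((ℕ→ℚ 2 * M - 1ℚ) * (ℕ→ℚ 2 * M - 1ℚ) * p + ℕ→ℚ 2 * (ℕ→ℚ 44 * M * M + ℕ→ℚ 22 * M + ℕ→ℚ 5) * q)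
  collect = solve-∀ ℚ-ring
  factor : ∀ M₁ r E → ℕ→ℚ 500 * (M₁ * (M₁ * - (ℤ.+ 1 / 500 * r * r * E))) + E
                      ≡ E + - (ℕ→ℚ 500 * (ℤ.+ 1 / 500) * (M₁ * r) * (M₁ * r) * E)
  factor = solve-∀ ℚ-ring
  cancel : ∀ E → E + - (1ℚ * 1ℚ * 1ℚ * E) ≡ 0ℚ
  cancel = solve-∀ ℚ-ring

h5-satisfies-θ-ode : h5-θ-ode h5 ≈ 0ˢ
h5-satisfies-θ-ode zero    = refl
h5-satisfies-θ-ode (suc m) = begin
  (⟨ 500 ⟩ ⊛ θ (θ h5)) (suc m) + (X ⊛ F₁) (suc m) + (X ⊛ (X ⊛ F₂)) (suc m)
    ≡⟨ cong₂ _+_ (cong₂ _+_ (const-⊛ _ (θ (θ h5)) (suc m)) (X⊛-suc F₁ m)) (X⊛-suc (X ⊛ F₂) m) ⟩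
  ℕ→ℚ 500 * θ (θ h5) (suc m) + F₁ m + (X ⊛ F₂) m
    ≡⟨ cong₂ (λ a b → ℕ→ℚ 500 * θ (θ h5) (suc m) + a + b) F₁-value (previous m) ⟩
  _ ≡⟨ cnext-recurrence m (proj₁ (cpair m)) (h5 m) ⟩
  0ℚ ∎
  where
  open ≡-Reasoning
  F₁ F₂ : Series
  F₁ = ⟨ 88 ⟩ ⊛ θ (θ h5) ⊕ ⟨ 44 ⟩ ⊛ θ h5 ⊕ ⟨ 10 ⟩ ⊛ h5
  F₂ = ⟨ 4 ⟩ ⊛ θ (θ h5) ⊕ ⟨ 4 ⟩ ⊛ θ h5 ⊕ h5
  F₁-value : F₁ m ≡ ℕ→ℚ 88 * θ (θ h5) m + ℕ→ℚ 44 * θ h5 m + ℕ→ℚ 10 * h5 m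
  F₁-value = cong₂ _+_ (cong₂ _+_ (const-⊛ _ (θ (θ h5)) m) (const-⊛ _ (θ h5) m)) (const-⊛ _ h5 m)
  square : ∀ J x → ℕ→ℚ 4 * (J * (J * x)) + ℕ→ℚ 4 * (J * x) + x
                 ≡ (ℕ→ℚ 2 * (1ℚ + J) - 1ℚ) * (ℕ→ℚ 2 * (1ℚ + J) - 1ℚ) * x
  square = solve-∀ ℚ-ring
  previous : ∀ m → (X ⊛ F₂) m ≡ (ℕ→ℚ 2 * ℕ→ℚ m - 1ℚ) * (ℕ→ℚ 2 * ℕ→ℚ m - 1ℚ) * proj₁ (cpair m)
  previous zero    = X⊛-zero F₂
  previous (suc j) = begin
    (X ⊛ F₂) (suc j)                                             ≡⟨ X⊛-suc F₂ j ⟩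
    F₂ j                                                         ≡⟨ cong (_+ h5 j) (cong₂ _+_ (const-⊛ _ (θ (θ h5)) j) (const-⊛ _ (θ h5) j)) ⟩
    ℕ→ℚ 4 * θ (θ h5) j + ℕ→ℚ 4 * θ h5 j + h5 j                   ≡⟨ square (ℕ→ℚ j) (h5 j) ⟩
    (ℕ→ℚ 2 * (1ℚ + ℕ→ℚ j) - 1ℚ) * (ℕ→ℚ 2 * (1ℚ + ℕ→ℚ j) - 1ℚ) * h5 j
      ≡⟨ cong (λ x → (ℕ→ℚ 2 * x - 1ℚ) * (ℕ→ℚ 2 * x - 1ℚ) * h5 j) (sym (ℕ→ℚ-homo-+ 1 j)) ⟩
    (ℕ→ℚ 2 * ℕ→ℚ (suc j) - 1ℚ) * (ℕ→ℚ 2 * ℕ→ℚ (suc j) - 1ℚ) * h5 j ∎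

θ²≈X⊛D : ∀ h → θ (θ h) ≈ X ⊛ D h ⊕ X ⊛ (X ⊛ D (D h))
θ²≈X⊛D h = begin
  θ (θ h)                        ≈⟨ θ-cong (θ≈X⊛D h) ⟩
  θ (X ⊛ D h)                    ≈⟨ θ-⊛ X (D h) ⟩
  θ X ⊛ D h ⊕ X ⊛ θ (D h)        ≈⟨ ⊕-cong (⊛-congʳ (D h) θ-X) (⊛-congˡ X (θ≈X⊛D (D h))) ⟩
  X ⊛ D h ⊕ X ⊛ (X ⊛ D (D h))    ∎
  where open ≈-Reasoning

h5-θ-ode≈X⊛h5-ode : ∀ h → h5-θ-ode h ≈ X ⊛ h5-ode X h (D h) (D (D h))
h5-θ-ode≈X⊛h5-ode h = begin
  h5-θ-ode h
    ≈⟨ ⊕-cong (⊕-cong (⊛-congˡ ⟨ 500 ⟩ θ²h)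
                      (⊛-congˡ X (⊕-congʳ (⟨ 10 ⟩ ⊛ h) (⊕-cong (⊛-congˡ ⟨ 88 ⟩ θ²h) (⊛-congˡ ⟨ 44 ⟩ θh)))))
              (⊛-congˡ X (⊛-congˡ X (⊕-congʳ h (⊕-cong (⊛-congˡ ⟨ 4 ⟩ θ²h) (⊛-congˡ ⟨ 4 ⟩ θh))))) ⟩
  ⟨ 500 ⟩ ⊛ θ²h′
  ⊕ X ⊛ (⟨ 88 ⟩ ⊛ θ²h′ ⊕ ⟨ 44 ⟩ ⊛ θh′ ⊕ ⟨ 10 ⟩ ⊛ h)
  ⊕ X ⊛ (X ⊛ (⟨ 4 ⟩ ⊛ θ²h′ ⊕ ⟨ 4 ⟩ ⊛ θh′ ⊕ h))
    ≈⟨ solve 4 (λ x y₀ y₁ y₂ →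
         κ 500 :* (x :* y₁ :+ x :* (x :* y₂))
         :+ x :* (κ 88 :* (x :* y₁ :+ x :* (x :* y₂)) :+ κ 44 :* (x :* y₁) :+ κ 10 :* y₀)
         :+ x :* (x :* (κ 4 :* (x :* y₁ :+ x :* (x :* y₂)) :+ κ 4 :* (x :* y₁) :+ y₀))
         := x :* (x :* quadratic′ 500 88 4 x :* y₂ :+ quadratic′ 500 132 8 x :* y₁ :+ quadratic′ 10 1 0 x :* y₀))
         ≈-refl X h (D h) (D (D h)) ⟩
  X ⊛ h5-ode X h (D h) (D (D h)) ∎
  where
  open ≈-Reasoning
  θh′ θ²h′ : Series
  θh′  = X ⊛ D h
  θ²h′ = X ⊛ D h ⊕ X ⊛ (X ⊛ D (D h))
  θh : θ h ≈ θh′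
  θh = θ≈X⊛D h
  θ²h : θ (θ h) ≈ θ²h′
  θ²h = θ²≈X⊛D h

h5-satisfies-ode : h5-ode X h5 (D h5) (D (D h5)) ≈ 0ˢ
h5-satisfies-ode = X⊛-cancel _ (≈-trans (≈-sym (h5-θ-ode≈X⊛h5-ode h5)) h5-satisfies-θ-ode)

homogeneous : ℕ → ℕ → ℕ → Series → Series → Series
homogeneous a b c u v = ⟨ a ⟩ ⊛ v ⊛ v ⊕ ⟨ b ⟩ ⊛ v ⊛ u ⊕ ⟨ c ⟩ ⊛ u ⊛ u

homogeneous′ : ∀ {m} → ℕ → ℕ → ℕ → Polynomial m → Polynomial m → Polynomial m
homogeneous′ a b c u v = κ a :* v :* v :+ κ b :* v :* u :+ κ c :* u :* u

homogeneous-cong : ∀ a b c {u u′} v → u ≈ u′ → homogeneous a b c u v ≈ homogeneous a b c u′ v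
homogeneous-cong a b c v u≈u′ =
  ⊕-cong (⊕-congˡ (⟨ a ⟩ ⊛ v ⊛ v) (⊛-congˡ (⟨ b ⟩ ⊛ v) u≈u′)) (⊛-cong (⊛-congˡ ⟨ c ⟩ u≈u′) u≈u′)

clear-h5-ode : ∀ a s t y₀ y₁ y₂ → a ⊛ s ≈ t →
  a ⊛ a ⊛ a ⊛ h5-ode s y₀ y₁ y₂
    ≈ t ⊛ homogeneous 500 88 4 t a ⊛ y₂ ⊕ a ⊛ homogeneous 500 132 8 t a ⊛ y₁ ⊕ a ⊛ homogeneous 10 1 0 t a ⊛ y₀
clear-h5-ode a s t y₀ y₁ y₂ as≈t = begin
  a ⊛ a ⊛ a ⊛ h5-ode s y₀ y₁ y₂
    ≈⟨ solve 5 (λ a s y₀ y₁ y₂ →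
         a :* a :* a :* (s :* quadratic′ 500 88 4 s :* y₂ :+ quadratic′ 500 132 8 s :* y₁ :+ quadratic′ 10 1 0 s :* y₀)
         := a :* s :* homogeneous′ 500 88 4 (a :* s) a :* y₂ :+ a :* homogeneous′ 500 132 8 (a :* s) a :* y₁
            :+ a :* homogeneous′ 10 1 0 (a :* s) a :* y₀)
         ≈-refl a s y₀ y₁ y₂ ⟩
  a ⊛ s ⊛ homogeneous 500 88 4 (a ⊛ s) a ⊛ y₂ ⊕ a ⊛ homogeneous 500 132 8 (a ⊛ s) a ⊛ y₁
    ⊕ a ⊛ homogeneous 10 1 0 (a ⊛ s) a ⊛ y₀
    ≈⟨ ⊕-cong (⊕-cong (⊛-congʳ y₂ (⊛-cong as≈t (homogeneous-cong 500 88 4 a as≈t)))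
                      (⊛-congʳ y₁ (⊛-congˡ a (homogeneous-cong 500 132 8 a as≈t))))
              (⊛-congʳ y₀ (⊛-congˡ a (homogeneous-cong 10 1 0 a as≈t))) ⟩
  t ⊛ homogeneous 500 88 4 t a ⊛ y₂ ⊕ a ⊛ homogeneous 500 132 8 t a ⊛ y₁ ⊕ a ⊛ homogeneous 10 1 0 t a ⊛ y₀ ∎
  where open ≈-Reasoning

-- Euler-type operators

euler : Series → Series → Series → Series → Series
euler p₂ p₁ p₀ y = p₂ ⊛ θ (θ y) ⊕ p₁ ⊛ θ y ⊕ p₀ ⊛ y

pullback-operator : Series → Series → Series → Series → Series → Series
pullback-operator a₂ a₁ a₀ g =
  euler (a₂ ⊛ θ g) (a₁ ⊛ θ g ⊛ θ g ⊕ ⊝ (a₂ ⊛ θ (θ g))) (a₀ ⊛ θ g ⊛ θ g ⊛ θ g)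

module _ (g : Series) (g₀≡0 : g 0 ≡ 0ℚ) where
  open Composition g g₀≡0

  ⟨⟩-∘ : ∀ a → ⟨ a ⟩ ∘ˢ g ≈ ⟨ a ⟩
  ⟨⟩-∘ a = ∘-const (ℤ→ℚ (ℤ.+ a))

  quadratic-∘ : ∀ a b c → quadratic a b c X ∘ˢ g ≈ quadratic a b c g
  quadratic-∘ a b c = begin
    (⟨ a ⟩ ⊕ ⟨ b ⟩ ⊛ X ⊕ ⟨ c ⟩ ⊛ X ⊛ X) ∘ˢ g
      ≈⟨ ∘-⊕ (⟨ a ⟩ ⊕ ⟨ b ⟩ ⊛ X) (⟨ c ⟩ ⊛ X ⊛ X) g ⟩
    (⟨ a ⟩ ⊕ ⟨ b ⟩ ⊛ X) ∘ˢ g ⊕ (⟨ c ⟩ ⊛ X ⊛ X) ∘ˢ g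
      ≈⟨ ⊕-cong (≈-trans (∘-⊕ ⟨ a ⟩ (⟨ b ⟩ ⊛ X) g) (⊕-cong (⟨⟩-∘ a) (linear b)))
                (≈-trans (∘-⊛ (⟨ c ⟩ ⊛ X) X) (⊛-cong (linear c) ∘-X)) ⟩
    ⟨ a ⟩ ⊕ ⟨ b ⟩ ⊛ g ⊕ ⟨ c ⟩ ⊛ g ⊛ g ∎
    where
    open ≈-Reasoning
    linear : ∀ b → (⟨ b ⟩ ⊛ X) ∘ˢ g ≈ ⟨ b ⟩ ⊛ g
    linear b = ≈-trans (∘-⊛ ⟨ b ⟩ X) (⊛-cong (⟨⟩-∘ b) ∘-X)

  h5-ode-∘ : ∀ y₀ y₁ y₂ → h5-ode X y₀ y₁ y₂ ∘ˢ g ≈ h5-ode g (y₀ ∘ˢ g) (y₁ ∘ˢ g) (y₂ ∘ˢ g)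
  h5-ode-∘ y₀ y₁ y₂ = begin
    (X ⊛ q₂ X ⊛ y₂ ⊕ q₁ X ⊛ y₁ ⊕ q₀ X ⊛ y₀) ∘ˢ g
      ≈⟨ ≈-trans (∘-⊕ (X ⊛ q₂ X ⊛ y₂ ⊕ q₁ X ⊛ y₁) (q₀ X ⊛ y₀) g)
                 (⊕-congʳ ((q₀ X ⊛ y₀) ∘ˢ g) (∘-⊕ (X ⊛ q₂ X ⊛ y₂) (q₁ X ⊛ y₁) g)) ⟩
    (X ⊛ q₂ X ⊛ y₂) ∘ˢ g ⊕ (q₁ X ⊛ y₁) ∘ˢ g ⊕ (q₀ X ⊛ y₀) ∘ˢ g
      ≈⟨ ⊕-cong (⊕-cong (≈-trans (∘-⊛ (X ⊛ q₂ X) y₂)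
                                 (⊛-congʳ (y₂ ∘ˢ g) (≈-trans (∘-⊛ X (q₂ X)) (⊛-cong ∘-X (quadratic-∘ 500 88 4)))))
                        (≈-trans (∘-⊛ (q₁ X) y₁) (⊛-congʳ (y₁ ∘ˢ g) (quadratic-∘ 500 132 8))))
                (≈-trans (∘-⊛ (q₀ X) y₀) (⊛-congʳ (y₀ ∘ˢ g) (quadratic-∘ 10 1 0))) ⟩
    h5-ode g (y₀ ∘ˢ g) (y₁ ∘ˢ g) (y₂ ∘ˢ g) ∎
    where
    open ≈-Reasoning
    q₂ q₁ q₀ : Series → Series
    q₂ = quadratic 500 88 4
    q₁ = quadratic 500 132 8
    q₀ = quadratic 10 1 0

  h5-ode-along : h5-ode g (h5 ∘ˢ g) (D h5 ∘ˢ g) (D (D h5) ∘ˢ g) ≈ 0ˢ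
  h5-ode-along = begin
    h5-ode g (h5 ∘ˢ g) (D h5 ∘ˢ g) (D (D h5) ∘ˢ g)   ≈⟨ h5-ode-∘ h5 (D h5) (D (D h5)) ⟨
    h5-ode X h5 (D h5) (D (D h5)) ∘ˢ g              ≈⟨ ∘-cong g h5-satisfies-ode ⟩
    0ˢ ∘ˢ g                                         ≈⟨ (λ n → sumBelow-zero (suc n) (λ k _ → ℚ.*-zeroˡ ((g ^ˢ k) n))) ⟩
    0ˢ                                              ∎
    where open ≈-Reasoning

  pullback-operator-∘ : ∀ a₂ a₁ a₀ f →
    pullback-operator a₂ a₁ a₀ g (f ∘ˢ g)
      ≈ θ g ⊛ θ g ⊛ θ g ⊛ (a₂ ⊛ (D (D f) ∘ˢ g) ⊕ a₁ ⊛ (D f ∘ˢ g) ⊕ a₀ ⊛ (f ∘ˢ g))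
  pullback-operator-∘ a₂ a₁ a₀ f = begin
    P₂ ⊛ θ (θ (f ∘ˢ g)) ⊕ P₁ ⊛ θ (f ∘ˢ g) ⊕ P₀ ⊛ (f ∘ˢ g)
      ≈⟨ ⊕-congʳ (P₀ ⊛ (f ∘ˢ g)) (⊕-cong (⊛-congˡ P₂ (chain-rule² f)) (⊛-congˡ P₁ (chain-rule f))) ⟩
    P₂ ⊛ ((D (D f) ∘ˢ g) ⊛ θ g ⊛ θ g ⊕ (D f ∘ˢ g) ⊛ θ (θ g)) ⊕ P₁ ⊛ ((D f ∘ˢ g) ⊛ θ g) ⊕ P₀ ⊛ (f ∘ˢ g)
      ≈⟨ solve 8 (λ a₂ a₁ a₀ tg ttg y₀ y₁ y₂ →
           a₂ :* tg :* (y₂ :* tg :* tg :+ y₁ :* ttg) :+ (a₁ :* tg :* tg :- a₂ :* ttg) :* (y₁ :* tg) :+ a₀ :* tg :* tg :* tg :* y₀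
           := tg :* tg :* tg :* (a₂ :* y₂ :+ a₁ :* y₁ :+ a₀ :* y₀))
           ≈-refl a₂ a₁ a₀ (θ g) (θ (θ g)) (f ∘ˢ g) (D f ∘ˢ g) (D (D f) ∘ˢ g) ⟩
    θ g ⊛ θ g ⊛ θ g ⊛ (a₂ ⊛ (D (D f) ∘ˢ g) ⊕ a₁ ⊛ (D f ∘ˢ g) ⊕ a₀ ⊛ (f ∘ˢ g)) ∎
    where
    open ≈-Reasoning
    P₂ P₁ P₀ : Series
    P₂ = a₂ ⊛ θ g
    P₁ = a₁ ⊛ θ g ⊛ θ g ⊕ ⊝ (a₂ ⊛ θ (θ g))
    P₀ = a₀ ⊛ θ g ⊛ θ g ⊛ θ g

euler-⊝ : ∀ p₂ p₁ p₀ y y′ → euler p₂ p₁ p₀ (y ⊕ ⊝ y′) ≈ euler p₂ p₁ p₀ y ⊕ ⊝ euler p₂ p₁ p₀ y′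
euler-⊝ p₂ p₁ p₀ y y′ = begin
  p₂ ⊛ θ (θ (y ⊕ ⊝ y′)) ⊕ p₁ ⊛ θ (y ⊕ ⊝ y′) ⊕ p₀ ⊛ (y ⊕ ⊝ y′)
    ≈⟨ ⊕-congʳ (p₀ ⊛ (y ⊕ ⊝ y′)) (⊕-cong (⊛-congˡ p₂ θθ-distrib) (⊛-congˡ p₁ θ-distrib)) ⟩
  p₂ ⊛ (θ (θ y) ⊕ ⊝ θ (θ y′)) ⊕ p₁ ⊛ (θ y ⊕ ⊝ θ y′) ⊕ p₀ ⊛ (y ⊕ ⊝ y′)
    ≈⟨ solve 9 (λ p₂ p₁ p₀ tty ty y tty′ ty′ y′ →
         p₂ :* (tty :- tty′) :+ p₁ :* (ty :- ty′) :+ p₀ :* (y :- y′)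
         := p₂ :* tty :+ p₁ :* ty :+ p₀ :* y :- (p₂ :* tty′ :+ p₁ :* ty′ :+ p₀ :* y′))
         ≈-refl p₂ p₁ p₀ (θ (θ y)) (θ y) y (θ (θ y′)) (θ y′) y′ ⟩
  euler p₂ p₁ p₀ y ⊕ ⊝ euler p₂ p₁ p₀ y′ ∎
  where
  open ≈-Reasoning
  θ-distrib : θ (y ⊕ ⊝ y′) ≈ θ y ⊕ ⊝ θ y′
  θ-distrib = ≈-trans (θ-⊕ y (⊝ y′)) (⊕-congˡ (θ y) (θ-⊝ y′))
  θθ-distrib : θ (θ (y ⊕ ⊝ y′)) ≈ θ (θ y) ⊕ ⊝ θ (θ y′)
  θθ-distrib = ≈-trans (θ-cong θ-distrib) (≈-trans (θ-⊕ (θ y) (⊝ θ y′)) (⊕-congˡ (θ (θ y)) (θ-⊝ (θ y′))))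

euler-cong : ∀ p₂ p₁ p₀ {y y′} → y ≈ y′ → euler p₂ p₁ p₀ y ≈ euler p₂ p₁ p₀ y′
euler-cong p₂ p₁ p₀ y≈y′ =
  ⊕-cong (⊕-cong (⊛-congˡ p₂ (θ-cong (θ-cong y≈y′))) (⊛-congˡ p₁ (θ-cong y≈y′))) (⊛-congˡ p₀ y≈y′)

euler-• : ∀ p₂ p₁ p₀ c y → euler p₂ p₁ p₀ (c • y) ≈ c • euler p₂ p₁ p₀ y
euler-• p₂ p₁ p₀ c y = begin
  euler p₂ p₁ p₀ (c • y)
    ≈⟨ euler-cong p₂ p₁ p₀ (•≈const⊛ c y) ⟩
  p₂ ⊛ θ (θ (const c ⊛ y)) ⊕ p₁ ⊛ θ (const c ⊛ y) ⊕ p₀ ⊛ (const c ⊛ y)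
    ≈⟨ ⊕-congʳ (p₀ ⊛ (const c ⊛ y)) (⊕-cong (⊛-congˡ p₂ (≈-trans (θ-cong (θ-const⊛ c y)) (θ-const⊛ c (θ y))))
                                             (⊛-congˡ p₁ (θ-const⊛ c y))) ⟩
  p₂ ⊛ (const c ⊛ θ (θ y)) ⊕ p₁ ⊛ (const c ⊛ θ y) ⊕ p₀ ⊛ (const c ⊛ y)
    ≈⟨ solve 7 (λ p₂ p₁ p₀ c tty ty y → p₂ :* (c :* tty) :+ p₁ :* (c :* ty) :+ p₀ :* (c :* y)
                 := c :* (p₂ :* tty :+ p₁ :* ty :+ p₀ :* y)) ≈-refl p₂ p₁ p₀ (const c) (θ (θ y)) (θ y) y ⟩
  const c ⊛ euler p₂ p₁ p₀ y
    ≈⟨ •≈const⊛ c (euler p₂ p₁ p₀ y) ⟨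
  c • euler p₂ p₁ p₀ y ∎
  where open ≈-Reasoning

module _ (k : ℕ) {p₂ p₁ p₀ : Series}
         (p₂≥k : OrderAtLeast k p₂) (p₁≥k : OrderAtLeast k p₁) (p₀≥k : OrderAtLeast k p₀)
         (indicial≢0 : ∀ m → p₂ k * (ℕ→ℚ (suc m) * ℕ→ℚ (suc m)) + p₁ k * ℕ→ℚ (suc m) + p₀ k ≢ 0ℚ)
         where

  private
    euler-zero-orders : ∀ {d} → euler p₂ p₁ p₀ d ≈ 0ˢ → d 0 ≡ 0ℚ → ∀ m → OrderAtLeast (suc m) d
    euler-zero-orders {d} Ld≈0 d₀≡0 zero    zero    _        = d₀≡0
    euler-zero-orders {d} Ld≈0 d₀≡0 zero    (suc n) (s≤s ())
    euler-zero-orders {d} Ld≈0 d₀≡0 (suc m) n n<2+m with ℕ.m≤n⇒m<n∨m≡n (ℕ.≤-pred n<2+m)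
    ... | inj₁ n<1+m = euler-zero-orders {d} Ld≈0 d₀≡0 m n n<1+m
    ... | inj₂ refl  = *≡0⇒≡0 (indicial≢0 m) (begin
      (p₂ k * (M * M) + p₁ k * M + p₀ k) * d (suc m)
        ≡⟨ factor (p₂ k) (p₁ k) (p₀ k) M (d (suc m)) ⟩
      p₂ k * θ (θ d) (suc m) + p₁ k * θ d (suc m) + p₀ k * d (suc m)
        ≡⟨ cong₂ _+_ (cong₂ _+_ (⊛-leading p₂≥k (θ-order (θ-order d≥1+m))) (⊛-leading p₁≥k (θ-order d≥1+m)))
                     (⊛-leading p₀≥k d≥1+m) ⟨
      euler p₂ p₁ p₀ d (k ℕ.+ suc m)
        ≡⟨ Ld≈0 (k ℕ.+ suc m) ⟩
      0ℚ ∎)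
      where
      open ≡-Reasoning
      M : ℚ
      M = ℕ→ℚ (suc m)
      d≥1+m : OrderAtLeast (suc m) d
      d≥1+m = euler-zero-orders {d} Ld≈0 d₀≡0 m
      factor : ∀ a b c M x → (a * (M * M) + b * M + c) * x ≡ a * (M * (M * x)) + b * (M * x) + c * x
      factor = solve-∀ ℚ-ring

  euler-unique : ∀ {y y′} → euler p₂ p₁ p₀ y ≈ euler p₂ p₁ p₀ y′ → y 0 ≡ y′ 0 → y ≈ y′
  euler-unique {y} {y′} Ly≈Ly′ y₀≡y′₀ n = begin
    y n                      ≡⟨ difference-zero ⟨
    (y ⊕ ⊝ y′) n + y′ n      ≡⟨ cong (_+ y′ n) (euler-zero-orders {y ⊕ ⊝ y′} Ld≈0 d₀≡0 n n ℕ.≤-refl) ⟩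
    0ℚ + y′ n                ≡⟨ ℚ.+-identityˡ (y′ n) ⟩
    y′ n                     ∎
    where
    open ≡-Reasoning
    difference-zero : (y ⊕ ⊝ y′) n + y′ n ≡ y n
    difference-zero = subtract-add (y n) (y′ n)
      where
      subtract-add : ∀ a b → a + - b + b ≡ a
      subtract-add = solve-∀ ℚ-ring
    Ld≈0 : euler p₂ p₁ p₀ (y ⊕ ⊝ y′) ≈ 0ˢ
    Ld≈0 m = trans (euler-⊝ p₂ p₁ p₀ y y′ m)
                   (trans (cong (λ a → a + - euler p₂ p₁ p₀ y′ m) (Ly≈Ly′ m)) (ℚ.+-inverseʳ (euler p₂ p₁ p₀ y′ m)))
    d₀≡0 : (y ⊕ ⊝ y′) 0 ≡ 0ℚ
    d₀≡0 = trans (cong (_+ - y′ 0) y₀≡y′₀) (ℚ.+-inverseʳ (y′ 0))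

T : Series
T = X ⊛ A

L : Series → Series
L = pullback-operator (T ⊛ quadratic 500 88 4 T) (quadratic 500 132 8 T) (quadratic 10 1 0 T) T

p₂ p₁ p₀ : Series
p₂ = T ⊛ quadratic 500 88 4 T ⊛ θ T
p₁ = quadratic 500 132 8 T ⊛ θ T ⊛ θ T ⊕ ⊝ (T ⊛ quadratic 500 88 4 T ⊛ θ (θ T))
p₀ = quadratic 10 1 0 T ⊛ θ T ⊛ θ T ⊛ θ T

-- Syntactic copies: ⟦_⟧ of each is definitionally the series it copies.
‵quadratic : ℕ → ℕ → ℕ → PolyExpr → PolyExpr
‵quadratic a b c z = ‵ a ‵+ ‵ b ‵* z ‵+ ‵ c ‵* z ‵* z

‵homogeneous : ℕ → ℕ → ℕ → PolyExpr → PolyExpr → PolyExpr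
‵homogeneous a b c u v = ‵ a ‵* v ‵* v ‵+ ‵ b ‵* v ‵* u ‵+ ‵ c ‵* u ‵* u

‵T ‵p₂ ‵p₁ ‵p₀ ‵X⁵ ‵K : PolyExpr
‵T  = ‵X ‵* ‵A
‵p₂ = ‵T ‵* ‵quadratic 500 88 4 ‵T ‵* ‵θ ‵T
‵p₁ = ‵quadratic 500 132 8 ‵T ‵* ‵θ ‵T ‵* ‵θ ‵T ‵- ‵T ‵* ‵quadratic 500 88 4 ‵T ‵* ‵θ (‵θ ‵T)
‵p₀ = ‵quadratic 10 1 0 ‵T ‵* ‵θ ‵T ‵* ‵θ ‵T ‵* ‵θ ‵T
‵X⁵ = ‵X ‵^ 5
‵K  = ‵A ‵* ‵θ ‵X⁵ ‵- ‵θ ‵A ‵* ‵X⁵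

-- The Cᵢ come out of cleared-operator and the Eᵢ out of clear-h5-ode along S = x⁵/A (below).
‵C₂ ‵C₁ ‵C₀ ‵E₂ ‵E₁ ‵E₀ ‵μ : PolyExpr
‵C₂ = ‵ 4 ‵* ‵p₂ ‵* ‵K ‵* ‵K
‵C₁ = ‵p₂ ‵* (‵ 4 ‵* ‵A ‵* ‵A ‵* ‵θ ‵K ‵- ‵ 12 ‵* ‵A ‵* ‵θ ‵A ‵* ‵K) ‵+ ‵ 4 ‵* ‵p₁ ‵* ‵A ‵* ‵A ‵* ‵K
‵C₀ = ‵p₂ ‵* ‵A ‵* ‵A ‵* (‵ 3 ‵* ‵θ ‵A ‵* ‵θ ‵A ‵- ‵ 2 ‵* ‵A ‵* ‵θ (‵θ ‵A))
      ‵- ‵ 2 ‵* ‵p₁ ‵* ‵A ‵* ‵A ‵* ‵A ‵* ‵θ ‵A ‵+ ‵ 4 ‵* ‵p₀ ‵* ‵A ‵* ‵A ‵* ‵A ‵* ‵A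
‵E₂ = ‵X⁵ ‵* ‵homogeneous 500 88 4 ‵X⁵ ‵A
‵E₁ = ‵A ‵* ‵homogeneous 500 132 8 ‵X⁵ ‵A
‵E₀ = ‵A ‵* ‵homogeneous 10 1 0 ‵X⁵ ‵A
‵μ  = ‵ 4 ‵* ‵X ‵^ 4 ‵* ‵A ‵* ‵θ ‵T ‵^ 3

C₂-factor : ⟦ ‵ 25 ‵* ‵C₂ ⟧ ≈ ⟦ ‵μ ‵* ‵E₂ ⟧
C₂-factor = ≈-by-coefficients (‵ 25 ‵* ‵C₂) (‵μ ‵* ‵E₂) refl

C₁-factor : ⟦ ‵ 25 ‵* ‵C₁ ⟧ ≈ ⟦ ‵μ ‵* ‵E₁ ⟧
C₁-factor = ≈-by-coefficients (‵ 25 ‵* ‵C₁) (‵μ ‵* ‵E₁) refl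

C₀-factor : ⟦ ‵ 25 ‵* ‵C₀ ⟧ ≈ ⟦ ‵μ ‵* ‵E₀ ⟧
C₀-factor = ≈-by-coefficients (‵ 25 ‵* ‵C₀) (‵μ ‵* ‵E₀) refl

module RightHandSide where

  B X⁵ S K : Series
  B  = AinvSqrt
  X⁵ = X ^ˢ 5
  S  = X⁵ ⊛ Ainv
  K  = ⟦ ‵K ⟧

  open Composition S refl

  A⊛S≈X⁵ : A ⊛ S ≈ X⁵
  A⊛S≈X⁵ = begin
    A ⊛ (X⁵ ⊛ Ainv)     ≈⟨ solve 3 (λ a x ai → a :* (x :* ai) := x :* (a :* ai)) ≈-refl A X⁵ Ainv ⟩
    X⁵ ⊛ (A ⊛ Ainv)     ≈⟨ ⊛-congˡ X⁵ A⊛Ainv≈1 ⟩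
    X⁵ ⊛ 1ˢ             ≈⟨ ≈-trans (⊛-comm X⁵ 1ˢ) (⊛-identityˡ X⁵) ⟩
    X⁵                  ∎
    where open ≈-Reasoning

  A²θS≈K : A ⊛ A ⊛ θ S ≈ K
  A²θS≈K = begin
    A ⊛ A ⊛ θ S
      ≈⟨ solve 4 (λ a ta s ts → a :* a :* ts := a :* (ta :* s :+ a :* ts) :- ta :* (a :* s)) ≈-refl A (θ A) S (θ S) ⟩
    A ⊛ (θ A ⊛ S ⊕ A ⊛ θ S) ⊕ ⊝ (θ A ⊛ (A ⊛ S))
      ≈⟨ ⊕-cong (⊛-congˡ A leibniz) (⊝-cong (⊛-congˡ (θ A) A⊛S≈X⁵)) ⟩
    A ⊛ θ X⁵ ⊕ ⊝ (θ A ⊛ X⁵) ∎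
    where
    open ≈-Reasoning
    leibniz : θ A ⊛ S ⊕ A ⊛ θ S ≈ θ X⁵
    leibniz = ≈-trans (≈-sym (θ-⊛ A S)) (θ-cong A⊛S≈X⁵)

  A⁴θ²S : A ⊛ A ⊛ A ⊛ A ⊛ θ (θ S) ≈ A ⊛ A ⊛ θ K ⊕ ⊝ (⟨ 2 ⟩ ⊛ A ⊛ θ A ⊛ K)
  A⁴θ²S = begin
    A ⊛ A ⊛ A ⊛ A ⊛ θ (θ S)
      ≈⟨ solve 4 (λ a ta ts tts → a :* a :* a :* a :* tts
                    := a :* a :* ((ta :* a :+ a :* ta) :* ts :+ a :* a :* tts) :- κ 2 :* a :* ta :* (a :* a :* ts))
                  ≈-refl A (θ A) (θ S) (θ (θ S)) ⟩
    A ⊛ A ⊛ ((θ A ⊛ A ⊕ A ⊛ θ A) ⊛ θ S ⊕ A ⊛ A ⊛ θ (θ S)) ⊕ ⊝ (⟨ 2 ⟩ ⊛ A ⊛ θ A ⊛ (A ⊛ A ⊛ θ S))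
      ≈⟨ ⊕-cong (⊛-congˡ (A ⊛ A) leibniz) (⊝-cong (⊛-congˡ (⟨ 2 ⟩ ⊛ A ⊛ θ A) A²θS≈K)) ⟩
    A ⊛ A ⊛ θ K ⊕ ⊝ (⟨ 2 ⟩ ⊛ A ⊛ θ A ⊛ K) ∎
    where
    open ≈-Reasoning
    leibniz : (θ A ⊛ A ⊕ A ⊛ θ A) ⊛ θ S ⊕ A ⊛ A ⊛ θ (θ S) ≈ θ K
    leibniz = ≈-trans (≈-sym (≈-trans (θ-⊛ (A ⊛ A) (θ S)) (⊕-congʳ (A ⊛ A ⊛ θ (θ S)) (⊛-congʳ (θ S) (θ-⊛ A A)))))
                      (θ-cong A²θS≈K)

  -- Differentiate r = 2AθB + BθA ≈ 0 and eliminate θB.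
  4A²θ²B : ⟨ 4 ⟩ ⊛ A ⊛ A ⊛ θ (θ B) ≈ B ⊛ (⟨ 3 ⟩ ⊛ θ A ⊛ θ A ⊕ ⊝ (⟨ 2 ⟩ ⊛ A ⊛ θ (θ A)))
  4A²θ²B = begin
    ⟨ 4 ⟩ ⊛ A ⊛ A ⊛ θ (θ B)
      ≈⟨ solve 6 (λ a ta tta b tb ttb →
           κ 4 :* a :* a :* ttb
           := b :* (κ 3 :* ta :* ta :- κ 2 :* a :* tta)
              :+ (κ 2 :* a :* (κ 2 :* (ta :* tb :+ a :* ttb) :+ (tb :* ta :+ b :* tta)) :- κ 3 :* ta :* (κ 2 :* (a :* tb) :+ b :* ta)))
           ≈-refl A (θ A) (θ (θ A)) B (θ B) (θ (θ B)) ⟩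
    B ⊛ (⟨ 3 ⟩ ⊛ θ A ⊛ θ A ⊕ ⊝ (⟨ 2 ⟩ ⊛ A ⊛ θ (θ A))) ⊕ (⟨ 2 ⟩ ⊛ A ⊛ r′ ⊕ ⊝ (⟨ 3 ⟩ ⊛ θ A ⊛ r))
      ≈⟨ ⊕-absorbs _ (⊕-vanishes (⊛-vanishes (⟨ 2 ⟩ ⊛ A) r′≈0) (⊝-vanishes (⊛-vanishes (⟨ 3 ⟩ ⊛ θ A) r≈0))) ⟩
    B ⊛ (⟨ 3 ⟩ ⊛ θ A ⊛ θ A ⊕ ⊝ (⟨ 2 ⟩ ⊛ A ⊛ θ (θ A))) ∎
    where
    open ≈-Reasoning
    r r′ : Series
    r  = ⟨ 2 ⟩ ⊛ (A ⊛ θ B) ⊕ B ⊛ θ A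
    r′ = ⟨ 2 ⟩ ⊛ (θ A ⊛ θ B ⊕ A ⊛ θ (θ B)) ⊕ (θ B ⊛ θ A ⊕ B ⊛ θ (θ A))
    r≈0 : r ≈ 0ˢ
    r≈0 n = trans (cong (_+ (B ⊛ θ A) n) (two-A-θAinvSqrt n)) (ℚ.+-inverseˡ ((B ⊛ θ A) n))
    r′≈0 : r′ ≈ 0ˢ
    r′≈0 = begin
      r′                       ≈⟨ ⊕-cong (⊛-congˡ ⟨ 2 ⟩ (θ-⊛ A (θ B))) (θ-⊛ B (θ A)) ⟨
      ⟨ 2 ⟩ ⊛ θ (A ⊛ θ B) ⊕ θ (B ⊛ θ A)   ≈⟨ ⊕-congʳ (θ (B ⊛ θ A)) (θ-const⊛ (ℤ→ℚ (ℤ.+ 2)) (A ⊛ θ B)) ⟨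
      θ (⟨ 2 ⟩ ⊛ (A ⊛ θ B)) ⊕ θ (B ⊛ θ A) ≈⟨ θ-⊕ (⟨ 2 ⟩ ⊛ (A ⊛ θ B)) (B ⊛ θ A) ⟨
      θ r                      ≈⟨ θ-cong r≈0 ⟩
      θ 0ˢ                     ≈⟨ (λ n → ℚ.*-zeroʳ (ℕ→ℚ n)) ⟩
      0ˢ                       ∎

  w₀ w₁ w₂ V : Series
  w₀ = h5 ∘ˢ S
  w₁ = D h5 ∘ˢ S
  w₂ = D (D h5) ∘ˢ S
  V  = B ⊛ w₀

  θV : θ V ≈ θ B ⊛ w₀ ⊕ B ⊛ (w₁ ⊛ θ S)
  θV = ≈-trans (θ-⊛ B w₀) (⊕-congˡ (θ B ⊛ w₀) (⊛-congˡ B (chain-rule h5)))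

  θ²V : θ (θ V) ≈ θ (θ B) ⊛ w₀ ⊕ ⟨ 2 ⟩ ⊛ (θ B ⊛ (w₁ ⊛ θ S)) ⊕ B ⊛ (w₂ ⊛ θ S ⊛ θ S ⊕ w₁ ⊛ θ (θ S))
  θ²V = ≈-trans (θ²-⊛ B w₀) (⊕-cong (⊕-congˡ (θ (θ B) ⊛ w₀) (⊛-congˡ ⟨ 2 ⟩ (⊛-congˡ (θ B) (chain-rule h5))))
                                     (⊛-congˡ B (chain-rule² h5)))

  C₂ C₁ C₀ : Series
  C₂ = ⟦ ‵C₂ ⟧
  C₁ = ⟦ ‵C₁ ⟧
  C₀ = ⟦ ‵C₀ ⟧

  cleared-operator : ⟨ 4 ⟩ ⊛ (A ⊛ (A ⊛ (A ⊛ (A ⊛ L V)))) ≈ B ⊛ (C₂ ⊛ w₂ ⊕ C₁ ⊛ w₁ ⊕ C₀ ⊛ w₀)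
  cleared-operator =
    ≈-trans (⊛-congˡ ⟨ 4 ⟩ (⊛-congˡ A (⊛-congˡ A (⊛-congˡ A (⊛-congˡ A expand-θ)))))
   (≈-trans (isolate p₂ p₁ p₀ A B (θ B) (θ (θ B)) (θ S) (θ (θ S)) w₀ w₁ w₂)
   (≈-trans (⊕-congʳ (⟨ 4 ⟩ ⊛ p₀ ⊛ A ⊛ A ⊛ A ⊛ A ⊛ B ⊛ w₀) (⊕-cong
              (⊛-congˡ p₂ (⊕-cong (⊕-cong (⊕-cong (⊛-congˡ (A ⊛ A ⊛ w₀) 4A²θ²B)
                                                    (⊛-cong (⊛-congˡ (⟨ 4 ⟩ ⊛ A ⊛ w₁) two-A-θAinvSqrt) A²θS≈K))
                                           (⊛-cong (⊛-congˡ (⟨ 4 ⟩ ⊛ B ⊛ w₂) A²θS≈K) A²θS≈K))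
                                  (⊛-congˡ (⟨ 4 ⟩ ⊛ B ⊛ w₁) A⁴θ²S)))
              (⊛-congˡ p₁ (⊕-cong (⊛-congˡ (⟨ 2 ⟩ ⊛ A ⊛ A ⊛ A ⊛ w₀) two-A-θAinvSqrt)
                                  (⊛-congˡ (⟨ 4 ⟩ ⊛ A ⊛ A ⊛ B ⊛ w₁) A²θS≈K)))))
            (collect p₂ p₁ p₀ A (θ A) (θ (θ A)) B K (θ K) w₀ w₁ w₂)))
    where
    expand-θ : L V ≈ p₂ ⊛ (θ (θ B) ⊛ w₀ ⊕ ⟨ 2 ⟩ ⊛ (θ B ⊛ (w₁ ⊛ θ S)) ⊕ B ⊛ (w₂ ⊛ θ S ⊛ θ S ⊕ w₁ ⊛ θ (θ S)))
                     ⊕ p₁ ⊛ (θ B ⊛ w₀ ⊕ B ⊛ (w₁ ⊛ θ S)) ⊕ p₀ ⊛ (B ⊛ w₀)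
    expand-θ = ⊕-congʳ (p₀ ⊛ V) (⊕-cong (⊛-congˡ p₂ θ²V) (⊛-congˡ p₁ θV))
    isolate : ∀ p₂ p₁ p₀ a b tb ttb ts tts w₀ w₁ w₂ →
      ⟨ 4 ⟩ ⊛ (a ⊛ (a ⊛ (a ⊛ (a ⊛ (p₂ ⊛ (ttb ⊛ w₀ ⊕ ⟨ 2 ⟩ ⊛ (tb ⊛ (w₁ ⊛ ts)) ⊕ b ⊛ (w₂ ⊛ ts ⊛ ts ⊕ w₁ ⊛ tts))
                                     ⊕ p₁ ⊛ (tb ⊛ w₀ ⊕ b ⊛ (w₁ ⊛ ts)) ⊕ p₀ ⊛ (b ⊛ w₀))))))
      ≈ p₂ ⊛ (a ⊛ a ⊛ w₀ ⊛ (⟨ 4 ⟩ ⊛ a ⊛ a ⊛ ttb) ⊕ ⟨ 4 ⟩ ⊛ a ⊛ w₁ ⊛ (⟨ 2 ⟩ ⊛ (a ⊛ tb)) ⊛ (a ⊛ a ⊛ ts)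
              ⊕ ⟨ 4 ⟩ ⊛ b ⊛ w₂ ⊛ (a ⊛ a ⊛ ts) ⊛ (a ⊛ a ⊛ ts) ⊕ ⟨ 4 ⟩ ⊛ b ⊛ w₁ ⊛ (a ⊛ a ⊛ a ⊛ a ⊛ tts))
        ⊕ p₁ ⊛ (⟨ 2 ⟩ ⊛ a ⊛ a ⊛ a ⊛ w₀ ⊛ (⟨ 2 ⟩ ⊛ (a ⊛ tb)) ⊕ ⟨ 4 ⟩ ⊛ a ⊛ a ⊛ b ⊛ w₁ ⊛ (a ⊛ a ⊛ ts))
        ⊕ ⟨ 4 ⟩ ⊛ p₀ ⊛ a ⊛ a ⊛ a ⊛ a ⊛ b ⊛ w₀
    isolate = solve 12 (λ p₂ p₁ p₀ a b tb ttb ts tts w₀ w₁ w₂ →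
      κ 4 :* (a :* (a :* (a :* (a :* (p₂ :* (ttb :* w₀ :+ κ 2 :* (tb :* (w₁ :* ts)) :+ b :* (w₂ :* ts :* ts :+ w₁ :* tts))
                                      :+ p₁ :* (tb :* w₀ :+ b :* (w₁ :* ts)) :+ p₀ :* (b :* w₀))))))
      := p₂ :* (a :* a :* w₀ :* (κ 4 :* a :* a :* ttb) :+ κ 4 :* a :* w₁ :* (κ 2 :* (a :* tb)) :* (a :* a :* ts)
                :+ κ 4 :* b :* w₂ :* (a :* a :* ts) :* (a :* a :* ts) :+ κ 4 :* b :* w₁ :* (a :* a :* a :* a :* tts))
         :+ p₁ :* (κ 2 :* a :* a :* a :* w₀ :* (κ 2 :* (a :* tb)) :+ κ 4 :* a :* a :* b :* w₁ :* (a :* a :* ts))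
         :+ κ 4 :* p₀ :* a :* a :* a :* a :* b :* w₀) ≈-refl
    collect : ∀ p₂ p₁ p₀ a ta tta b k tk w₀ w₁ w₂ →
      p₂ ⊛ (a ⊛ a ⊛ w₀ ⊛ (b ⊛ (⟨ 3 ⟩ ⊛ ta ⊛ ta ⊕ ⊝ (⟨ 2 ⟩ ⊛ a ⊛ tta))) ⊕ ⟨ 4 ⟩ ⊛ a ⊛ w₁ ⊛ ⊝ (b ⊛ ta) ⊛ k
            ⊕ ⟨ 4 ⟩ ⊛ b ⊛ w₂ ⊛ k ⊛ k ⊕ ⟨ 4 ⟩ ⊛ b ⊛ w₁ ⊛ (a ⊛ a ⊛ tk ⊕ ⊝ (⟨ 2 ⟩ ⊛ a ⊛ ta ⊛ k)))
      ⊕ p₁ ⊛ (⟨ 2 ⟩ ⊛ a ⊛ a ⊛ a ⊛ w₀ ⊛ ⊝ (b ⊛ ta) ⊕ ⟨ 4 ⟩ ⊛ a ⊛ a ⊛ b ⊛ w₁ ⊛ k)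
      ⊕ ⟨ 4 ⟩ ⊛ p₀ ⊛ a ⊛ a ⊛ a ⊛ a ⊛ b ⊛ w₀
      ≈ b ⊛ (⟨ 4 ⟩ ⊛ p₂ ⊛ k ⊛ k ⊛ w₂
             ⊕ (p₂ ⊛ (⟨ 4 ⟩ ⊛ a ⊛ a ⊛ tk ⊕ ⊝ (⟨ 12 ⟩ ⊛ a ⊛ ta ⊛ k)) ⊕ ⟨ 4 ⟩ ⊛ p₁ ⊛ a ⊛ a ⊛ k) ⊛ w₁
             ⊕ (p₂ ⊛ a ⊛ a ⊛ (⟨ 3 ⟩ ⊛ ta ⊛ ta ⊕ ⊝ (⟨ 2 ⟩ ⊛ a ⊛ tta)) ⊕ ⊝ (⟨ 2 ⟩ ⊛ p₁ ⊛ a ⊛ a ⊛ a ⊛ ta)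
                ⊕ ⟨ 4 ⟩ ⊛ p₀ ⊛ a ⊛ a ⊛ a ⊛ a) ⊛ w₀)
    collect = solve 12 (λ p₂ p₁ p₀ a ta tta b k tk w₀ w₁ w₂ →
      p₂ :* (a :* a :* w₀ :* (b :* (κ 3 :* ta :* ta :- κ 2 :* a :* tta)) :+ κ 4 :* a :* w₁ :* (:- (b :* ta)) :* k
             :+ κ 4 :* b :* w₂ :* k :* k :+ κ 4 :* b :* w₁ :* (a :* a :* tk :- κ 2 :* a :* ta :* k))
      :+ p₁ :* (κ 2 :* a :* a :* a :* w₀ :* (:- (b :* ta)) :+ κ 4 :* a :* a :* b :* w₁ :* k)
      :+ κ 4 :* p₀ :* a :* a :* a :* a :* b :* w₀
      := b :* (κ 4 :* p₂ :* k :* k :* w₂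
               :+ (p₂ :* (κ 4 :* a :* a :* tk :- κ 12 :* a :* ta :* k) :+ κ 4 :* p₁ :* a :* a :* k) :* w₁
               :+ (p₂ :* a :* a :* (κ 3 :* ta :* ta :- κ 2 :* a :* tta) :- κ 2 :* p₁ :* a :* a :* a :* ta
                   :+ κ 4 :* p₀ :* a :* a :* a :* a) :* w₀)) ≈-refl

  μ E₂ E₁ E₀ : Series
  μ  = ⟦ ‵μ ⟧
  E₂ = ⟦ ‵E₂ ⟧
  E₁ = ⟦ ‵E₁ ⟧
  E₀ = ⟦ ‵E₀ ⟧

  V-operator : L V ≈ 0ˢ
  V-operator = A⊛-cancel _ (A⊛-cancel _ (A⊛-cancel _ (A⊛-cancel _ (⟨suc⟩⊛-cancel 3 _ (⟨suc⟩⊛-cancel 24 _ (begin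
    ⟨ 25 ⟩ ⊛ (⟨ 4 ⟩ ⊛ (A ⊛ (A ⊛ (A ⊛ (A ⊛ L V)))))
      ≈⟨ ⊛-congˡ ⟨ 25 ⟩ cleared-operator ⟩
    ⟨ 25 ⟩ ⊛ (B ⊛ (C₂ ⊛ w₂ ⊕ C₁ ⊛ w₁ ⊕ C₀ ⊛ w₀))
      ≈⟨ solve 7 (λ b c₂ c₁ c₀ w₀ w₁ w₂ → κ 25 :* (b :* (c₂ :* w₂ :+ c₁ :* w₁ :+ c₀ :* w₀))
                   := b :* (κ 25 :* c₂ :* w₂ :+ κ 25 :* c₁ :* w₁ :+ κ 25 :* c₀ :* w₀)) ≈-refl B C₂ C₁ C₀ w₀ w₁ w₂ ⟩
    B ⊛ (⟨ 25 ⟩ ⊛ C₂ ⊛ w₂ ⊕ ⟨ 25 ⟩ ⊛ C₁ ⊛ w₁ ⊕ ⟨ 25 ⟩ ⊛ C₀ ⊛ w₀)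
      ≈⟨ ⊛-congˡ B (⊕-cong (⊕-cong (⊛-congʳ w₂ C₂-factor) (⊛-congʳ w₁ C₁-factor)) (⊛-congʳ w₀ C₀-factor)) ⟩
    B ⊛ (μ ⊛ E₂ ⊛ w₂ ⊕ μ ⊛ E₁ ⊛ w₁ ⊕ μ ⊛ E₀ ⊛ w₀)
      ≈⟨ solve 8 (λ b m e₂ e₁ e₀ w₀ w₁ w₂ → b :* (m :* e₂ :* w₂ :+ m :* e₁ :* w₁ :+ m :* e₀ :* w₀)
                   := b :* m :* (e₂ :* w₂ :+ e₁ :* w₁ :+ e₀ :* w₀)) ≈-refl B μ E₂ E₁ E₀ w₀ w₁ w₂ ⟩
    B ⊛ μ ⊛ (E₂ ⊛ w₂ ⊕ E₁ ⊛ w₁ ⊕ E₀ ⊛ w₀)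
      ≈⟨ ⊛-congˡ (B ⊛ μ) (clear-h5-ode A S X⁵ w₀ w₁ w₂ A⊛S≈X⁵) ⟨
    B ⊛ μ ⊛ (A ⊛ A ⊛ A ⊛ h5-ode S w₀ w₁ w₂)
      ≈⟨ ⊛-vanishes (B ⊛ μ) (⊛-vanishes (A ⊛ A ⊛ A) (h5-ode-along S refl)) ⟩
    0ˢ ∎))))))
    where open ≈-Reasoning

lhs-operator : L lhs ≈ 0ˢ
lhs-operator = ≈-trans (pullback-operator-∘ T refl (T ⊛ quadratic 500 88 4 T) (quadratic 500 132 8 T) (quadratic 10 1 0 T) h5)
                       (⊛-vanishes (θ T ⊛ θ T ⊛ θ T) (h5-ode-along T refl))

rhs-operator : L rhs ≈ 0ˢ
rhs-operator = ≈-trans (euler-• p₂ p₁ p₀ (ℕ→ℚ 5) RightHandSide.V)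
                       (λ n → trans (cong (ℕ→ℚ 5 *_) (RightHandSide.V-operator n)) (ℚ.*-zeroʳ (ℕ→ℚ 5)))

p₂≥2 : OrderAtLeast 2 p₂
p₂≥2 0 _ = refl
p₂≥2 1 _ = refl
p₂≥2 (suc (suc n)) (s≤s (s≤s ()))

p₁≥2 : OrderAtLeast 2 p₁
p₁≥2 0 _ = refl
p₁≥2 1 _ = refl
p₁≥2 (suc (suc n)) (s≤s (s≤s ()))

p₀≥2 : OrderAtLeast 2 p₀
p₀≥2 0 _ = refl
p₀≥2 1 _ = refl
p₀≥2 (suc (suc n)) (s≤s (s≤s ()))

indicial≢0 : ∀ m → p₂ 2 * (ℕ→ℚ (suc m) * ℕ→ℚ (suc m)) + p₁ 2 * ℕ→ℚ (suc m) + p₀ 2 ≢ 0ℚ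
indicial≢0 m eq = ℕ→ℚ-suc≢0 m (*≡0⇒≡0 (ℕ→ℚ-suc≢0 m) (*≡0⇒≡0 (ℕ→ℚ-suc≢0 312499) (trans (sym (simplify M)) eq)))
  where
  M : ℚ
  M = ℕ→ℚ (suc m)
  simplify : ∀ M → ℕ→ℚ 312500 * (M * M) + 0ℚ * M + 0ℚ ≡ ℕ→ℚ 312500 * (M * M)
  simplify = solve-∀ ℚ-ring

proposition1p1 : (n : ℕ) → lhs n ≡ rhs n
proposition1p1 = euler-unique 2 p₂≥2 p₁≥2 p₀≥2 indicial≢0 (≈-trans lhs-operator (≈-sym rhs-operator)) refl
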